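{- Let $L=K(x_0,\dots,x_n)/K$ be a near one-dimensional elementary abelian extension with data as in the context (in particular satisfying the error bounds on $\epsilon_i$). For $0\le i\le n$ let $b_{(i)}=b+p^n\sum_{j=1}^{i}p^jm_j$. Then for $1\le i\le n$, $$v_K(E_i^{(i-1)})>-b_{(i)}/p^i .$$
   Context: $p$ prime, $\mathbb{F}$ a finite field of characteristic $p$ or $\overline{\mathbb{F}}_p$, $K=\mathbb{F}((t))$, $v_K$ normalized valuation, $\mathfrak O_K,\mathfrak P_K$, $\wp(x)=x^p-x$, $\phi(x)=x^p$. Near one-dimensional elementary abelian extension: a fully ramified Galois extension $L/K$ of degree $p^{n+1}$ with $L=K(x_0,\dots,x_n)$, $x_i^p-x_i=\phi^n(\Omega_i)\beta+\epsilon_i$, where $\beta\in K$, $v_K(\beta)=-b$, $b>0$, $\gcd(b,p)=1$; $\Omega_0,\dots,\Omega_n\in K$ linearly independent over $\mathbb{F}_p$, $\Omega_0=1$, $v_K(\Omega_n)\le\cdots\le v_K(\Omega_0)=0$; whenever $v_K(\Omega_i)=\cdots=v_K(\Omega_j)$, $i<j$, the images of $\phi^n(\Omega_i)\beta,\dots,\phi^n(\Omega_j)\beta$ in $\phi^n(\Omega_i)\beta\mathfrak O_K/\phi^n(\Omega_i)\beta\mathfrak P_K$ are $\mathbb{F}_p$-independent; $\epsilon_0=0$ and with $m_j=v_K(\Omega_{j-1})-v_K(\Omega_j)$, $v_K(\epsilon_i)>-\frac{b}{p^n}-\sum_{j=1}^{i}p^jm_j+\sum_{j=i+1}^{n}(p^n-p^j)m_j$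 for $1\le i\le n$. Define $\Omega_j^{(0)}=\Omega_j$, $\Omega_j^{(i)}=\wp(\Omega_j^{(i-1)})/\wp(\Omega_i^{(i-1)})$ for $1\le i\le j\le n$. Define $E_j^{(0)}=\epsilon_j$ and for $1\le i<j\le n$, $E_j^{(i)}=E_j^{(i-1)}-\phi^{n-i}(\Omega_j^{(i)})E_i^{(i-1)}$. -}

module Defs where

open import Level using (Level; _⊔_)
open import Algebra.Bundles using (CommutativeRing)
open import Data.Nat as ℕ using (ℕ; zero; suc; _∸_)
open import Data.Integer as ℤ using (ℤ; +_; -[1+_])
open import Data.List using (List; []; _∷_; length; map)
open import Data.List.Relation.Unary.Any using (Any)
open import Data.Product using (_×_; ∃; Σ)
open import Data.Sum using (_⊎_)
open import Relation.Nullary using (¬_)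
open import Relation.Binary.PropositionalEquality using (_≡_)

private variable c ℓ : Level

-- Everything is parameterised by the coefficient ring 𝔽 (a commutative ring;
-- field-ness, characteristic and finiteness / algebraic closure are stated
-- as separate predicates below).
module Over (R : CommutativeRing c ℓ) where
  open CommutativeRing R

  natF : ℕ → Carrier
  natF zero    = 0#
  natF (suc m) = 1# + natF m

  _^F_ : Carrier → ℕ → Carrier
  x ^F zero  = 1#
  x ^F suc k = x * (x ^F k)

  IsField : Set (c ⊔ ℓ)
  IsField = (¬ (0# ≈ 1#)) × (∀ x → ¬ (x ≈ 0#) → ∃ λ y → (x * y) ≈ 1#)

  -- characteristic p (for p prime this means char 𝔽 = p)
  HasChar : ℕ → Set ℓ
  HasChar p = natF p ≈ 0#

  Finite : Set (c ⊔ ℓ)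
  Finite = ∃ λ (xs : List Carrier) → ∀ x → Any (x ≈_) xs

  evalPoly : List Carrier → Carrier → Carrier
  evalPoly []       x = 0#
  evalPoly (a ∷ as) x = a + (x * evalPoly as x)

  evalMonic : List Carrier → Carrier → Carrier
  evalMonic as x = (x ^F length as) + evalPoly as x

  AlgClosed : Set (c ⊔ ℓ)
  AlgClosed = ∀ (as : List Carrier) → ¬ (as ≡ []) → ∃ λ x → evalMonic as x ≈ 0#

  AlgebraicOverPrimeField : Set (c ⊔ ℓ)
  AlgebraicOverPrimeField = ∀ x → ∃ λ (as : List ℕ) → evalMonic (map natF as) x ≈ 0#

  IsAlgClosureOfFp : Set (c ⊔ ℓ)
  IsAlgClosureOfFp = AlgClosed × AlgebraicOverPrimeField

  AdmissibleField : ℕ → Set (c ⊔ ℓ)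
  AdmissibleField p = IsField × HasChar p × (Finite ⊎ IsAlgClosureOfFp)

  -- K = 𝔽((t)): a Laurent series is  t^ord · Σ_{m ≥ 0} cf m · t^m

  record Laurent : Set c where
    constructor laurent
    field
      ord : ℤ
      cf  : ℕ → Carrier
  open Laurent public

  private
    at : (ℕ → Carrier) → ℤ → Carrier
    at f (+ m)     = f m
    at f -[1+ m ]  = 0#

  coef : Laurent → ℤ → Carrier
  coef x k = at (cf x) (k ℤ.- ord x)

  _≈L_ : Laurent → Laurent → Set ℓ
  x ≈L y = ∀ k → coef x k ≈ coef y k

  sumF : (ℕ → Carrier) → ℕ → Carrier
  sumF f zero    = 0#
  sumF f (suc n) = sumF f n + f n

  0L 1L : Laurent
  0L = laurent (+ 0) (λ _ → 0#)
  1L = laurent (+ 0) (λ { zero → 1# ; (suc _) → 0# })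

  _+L_ : Laurent → Laurent → Laurent
  x +L y = laurent o (λ m → coef x (o ℤ.+ + m) + coef y (o ℤ.+ + m))
    where o = ord x ℤ.⊓ ord y

  -L_ : Laurent → Laurent
  -L x = laurent (ord x) (λ m → - cf x m)

  _-L_ : Laurent → Laurent → Laurent
  x -L y = x +L (-L y)

  _*L_ : Laurent → Laurent → Laurent
  x *L y = laurent (ord x ℤ.+ ord y)
                   (λ m → sumF (λ j → cf x j * cf y (m ∸ j)) (suc m))

  _·L_ : Carrier → Laurent → Laurent
  a ·L x = laurent (ord x) (λ m → a * cf x m)

  _^L_ : Laurent → ℕ → Laurent
  x ^L zero  = 1L
  x ^L suc k = x *L (x ^L k)

  ℘ : ℕ → Laurent → Laurent
  ℘ p x = (x ^L p) -L x

  φ^ : ℕ → ℕ → Laurent → Laurent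
  φ^ p k x = x ^L (p ℕ.^ k)

  -- Σ_{k = a}^{b} f k  (empty if b < a), computed as a sum of (suc b ∸ a) terms
  sumFromL : (ℕ → Laurent) → ℕ → ℕ → Laurent
  sumFromL f a zero    = 0L
  sumFromL f a (suc l) = sumFromL f a l +L f (a ℕ.+ l)

  ΣL[_,_] : ℕ → ℕ → (ℕ → Laurent) → Laurent
  ΣL[ a , b ] f = sumFromL f a (suc b ∸ a)

  HasVal : Laurent → ℤ → Set ℓ
  HasVal x w = (¬ (coef x w ≈ 0#)) × (∀ k → k ℤ.< w → coef x k ≈ 0#)

  -- v_K(x) ≥ u   (true for x = 0)
  ValGe : Laurent → ℤ → Set ℓ
  ValGe x u = ∀ k → k ℤ.< u → coef x k ≈ 0#

  -- v_K(x) > num / den   (den > 0; true for x = 0):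
  -- every k ∈ ℤ with k ≤ num/den, i.e. k·den ≤ num, has zero coefficient
  ValGtFrac : Laurent → ℤ → ℕ → Set ℓ
  ValGtFrac x num den = ∀ k → (k ℤ.* + den) ℤ.≤ num → coef x k ≈ 0#

  InAP : Laurent → Laurent → Set (c ⊔ ℓ)
  InAP a x = ∃ λ z → ValGe z (+ 1) × (x ≈L (a *L z))

  LinIndepFp : ℕ → ℕ → (ℕ → Laurent) → Set ℓ
  LinIndepFp p n Ω =
    ∀ (a : ℕ → ℕ) → (∀ i → i ℕ.≤ n → a i ℕ.< p) →
    ΣL[ 0 , n ] (λ i → natF (a i) ·L Ω i) ≈L 0L →
    ∀ i → i ℕ.≤ n → a i ≡ 0

  -- whenever v(Ω_i) = … = v(Ω_j), i < j, the images of φⁿ(Ω_i)β,…,φⁿ(Ω_j)β in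
  -- φⁿ(Ω_i)β𝔒_K / φⁿ(Ω_i)β𝔓_K are 𝔽_p-independent
  -- (a combination has zero image iff it lies in φⁿ(Ω_i)β𝔓_K)
  ResidueIndep : ℕ → ℕ → (ℕ → Laurent) → Laurent → (ℕ → ℤ) → Set (c ⊔ ℓ)
  ResidueIndep p n Ω β w =
    ∀ i j → i ℕ.< j → j ℕ.≤ n →
    (∀ k → i ℕ.≤ k → k ℕ.≤ j → w k ≡ w i) →
    ∀ (a : ℕ → ℕ) → (∀ k → i ℕ.≤ k → k ℕ.≤ j → a k ℕ.< p) →
    InAP (φ^ p n (Ω i) *L β) (ΣL[ i , j ] (λ k → natF (a k) ·L (φ^ p n (Ω k) *L β))) →
    ∀ k → i ℕ.≤ k → k ℕ.≤ j → a k ≡ 0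

  -- E_j^{(0)} = ε_j,  E_j^{(i)} = E_j^{(i-1)} − φ^{n−i}(Ω_j^{(i)}) E_i^{(i-1)};
  -- E j i stands for E_j^{(i)}, Om i j for Ω_j^{(i)}
  E : ℕ → ℕ → (ℕ → ℕ → Laurent) → (ℕ → Laurent) → ℕ → ℕ → Laurent
  E p n Om ε j zero    = ε j
  E p n Om ε j (suc i) =
    E p n Om ε j i -L (φ^ p (n ∸ suc i) (Om (suc i) j) *L E p n Om ε (suc i) i)

sumFromZ : (ℕ → ℤ) → ℕ → ℕ → ℤ
sumFromZ f a zero    = + 0
sumFromZ f a (suc l) = sumFromZ f a l ℤ.+ f (a ℕ.+ l)

ΣZ[_,_] : ℕ → ℕ → (ℕ → ℤ) → ℤ
ΣZ[ a , b ] f = sumFromZ f a (suc b ∸ a)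

-- The Ω_j^{(i)} are controlled by an induction on i: v_K(Ω_j^{(i)}) = p^i (v_K(Ω_j) − v_K(Ω_i)),
-- Ω_i^{(i)} has leading coefficient 1, and on every block of indices where v_K(Ω_j) is constant
-- the leading coefficients of the Ω_j^{(i)} are 𝔽_p-independent. For i = 0 the independence is
-- the residue condition on the φⁿ(Ω_j)β, transported to leading coefficients by Frobenius. In the
-- step, Ω_j^{(i+1)} = ℘(Ω_j^{(i)}) / ℘(Ω_{i+1}^{(i)}) has the claimed valuation once the leading
-- coefficient of ℘(Ω_{i+1}^{(i)}) is nonzero: it is c^p for valuation < 0, and c^p − c for
-- valuation 0, nonzero because c ∉ 𝔽_p by independence from the leading coefficient 1 of Ω_i^{(i)}.
-- Independence propagates since x ↦ x^p resp. x ↦ x^p − x are additive with kernel 0 resp. 𝔽_p.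
-- With these valuations the recursion for E_j^{(i)} telescopes the bounds on the ε_i into
-- v_K(E_j^{(i)}) > (bound for ε_j)/pⁿ, and the bound for j = i dominates −b_{(i)}/p^i.
module Submission where

open import Level using (Level; _⊔_)
open import Data.Empty using (⊥-elim)
open import Data.Product using (_×_; _,_; ∃; Σ; proj₁; proj₂)
open import Data.Sum using (_⊎_; inj₁; inj₂)
open import Data.Maybe using (nothing)
open import Relation.Nullary using (¬_; yes; no)
open import Relation.Nullary.Decidable using (decidable-stable)
open import Relation.Binary using (tri<; tri≈; tri>)
open import Relation.Binary.PropositionalEquality as P using (_≡_; _≢_)
open import Data.Nat as ℕ using (ℕ; zero; suc; _∸_; z≤n; s≤s)
import Data.Nat.Properties as ℕP
open import Data.Nat.Primality using (Prime; prime; euclidsLemma)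
open import Data.Nat.Coprimality using (Coprime; prime⇒coprime; coprime-Bézout)
open import Data.Nat.GCD using (module Bézout)
open import Data.Nat.Divisibility using (_∣_; ∣1⇒≡1; ∣⇒≤; m∣m*n; divides)
open import Data.Nat.Combinatorics using (_C_; nCn≡1; nCk≡n!/k![n-k]!; k![n∸k]!∣n!)
open import Data.Nat.DivMod using (m/n*n≡m)
open import Data.Integer as ℤ using (ℤ; +_; -[1+_])
import Data.Integer.Properties as ℤP
open import Data.Integer.Tactic.RingSolver using (solve-∀)
open import Data.Fin as Fin using (Fin; toℕ)
import Data.Fin.Properties as FinP
import Data.Vec.Functional as Vec
open import Algebra.Bundles using (CommutativeRing)
import Tactic.RingSolver.Core.AlmostCommutativeRing as ACR
open import Defs

range-bound : ∀ s t j → j ℕ.< suc t ∸ s → s ℕ.+ j ℕ.≤ t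
range-bound zero          t       j j<1+t = ℕP.≤-pred j<1+t
range-bound (suc s)       (suc t) j j<    = s≤s (range-bound s t j j<)
range-bound (suc zero)    zero    j ()
range-bound (suc (suc s)) zero    j ()

prime>1 : ∀ {p} → Prime p → 1 ℕ.< p
prime>1 {p} (prime ⦃ nt ⦄ _) = ℕ.nonTrivial⇒n>1 p

prime>0 : ∀ {p} → Prime p → 0 ℕ.< p
prime>0 prime-p = ℕP.<-trans ℕP.0<1+n (prime>1 prime-p)

prime∤m! : ∀ {p} → Prime p → ∀ m → m ℕ.< p → ¬ (p ∣ m ℕ.!)
prime∤m! prime-p zero    _   p∣1     = ℕP.<-irrefl (P.sym (∣1⇒≡1 p∣1)) (prime>1 prime-p)
prime∤m! prime-p (suc m) m<p p∣m+1!  with euclidsLemma (suc m) (m ℕ.!) prime-p p∣m+1!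
... | inj₁ p∣m+1 = ℕP.<-irrefl P.refl (ℕP.≤-<-trans (∣⇒≤ p∣m+1) m<p)
... | inj₂ p∣m!  = prime∤m! prime-p m (ℕP.<-trans (ℕP.n<1+n m) m<p) p∣m!

-- p divides p! = (p C k) · k! · (p − k)!, but neither of the factorials.
prime∣pCk : ∀ {p} → Prime p → ∀ k → 0 ℕ.< k → k ℕ.< p → p ∣ (p C k)
prime∣pCk {p} prime-p k 0<k k<p with euclidsLemma (p C k) (k ℕ.! ℕ.* (p ∸ k) ℕ.!) prime-p p∣product
  where
  instance _ = ℕP._!*_!≢0 k (p ∸ k)
  p∣product : p ∣ (p C k) ℕ.* (k ℕ.! ℕ.* (p ∸ k) ℕ.!)
  p∣product = P.subst (p ∣_)
    (P.sym (P.trans (P.cong (ℕ._* (k ℕ.! ℕ.* (p ∸ k) ℕ.!)) (nCk≡n!/k![n-k]! (ℕP.<⇒≤ k<p)))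
                    (m/n*n≡m (k![n∸k]!∣n! (ℕP.<⇒≤ k<p)))))
    (P.subst (λ q → q ∣ q ℕ.!) (ℕP.suc-pred p ⦃ ℕ.>-nonZero (prime>0 prime-p) ⦄)
             (m∣m*n (ℕ.pred p ℕ.!)))
... | inj₁ p∣pCk = p∣pCk
... | inj₂ p∣k!*[p-k]! with euclidsLemma (k ℕ.!) ((p ∸ k) ℕ.!) prime-p p∣k!*[p-k]!
...   | inj₁ p∣k!     = ⊥-elim (prime∤m! prime-p k k<p p∣k!)
...   | inj₂ p∣[p-k]! = ⊥-elim (prime∤m! prime-p (p ∸ k) (ℕP.∸-monoʳ-< {p} {k} {0} 0<k (ℕP.<⇒≤ k<p)) p∣[p-k]!)

adjoin : ℕ → ℕ → (ℕ → ℕ) → ℕ → ℕ → ℕ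
adjoin i u a s k with k ℕ.≟ i
... | yes _ = u
... | no  _ with k ℕ.<? s
...   | yes _ = 0
...   | no  _ = a k

adjoin-at : ∀ i u a s → adjoin i u a s i ≡ u
adjoin-at i u a s with i ℕ.≟ i
... | yes _  = P.refl
... | no i≢i = ⊥-elim (i≢i P.refl)

adjoin-gap : ∀ i u a s k → i ℕ.< k → k ℕ.< s → adjoin i u a s k ≡ 0
adjoin-gap i u a s k i<k k<s with k ℕ.≟ i
... | yes P.refl = ⊥-elim (ℕP.<-irrefl P.refl i<k)
... | no  _ with k ℕ.<? s
...   | yes _   = P.refl
...   | no  k≮s = ⊥-elim (k≮s k<s)

adjoin-beyond : ∀ i u a s k → i ℕ.< s → s ℕ.≤ k → adjoin i u a s k ≡ a k
adjoin-beyond i u a s k i<s s≤k with k ℕ.≟ i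
... | yes P.refl = ⊥-elim (ℕP.<⇒≱ i<s s≤k)
... | no  _ with k ℕ.<? s
...   | yes k<s = ⊥-elim (ℕP.<⇒≱ k<s s≤k)
...   | no  _   = P.refl

adjoin-< : ∀ {p} i u a s t → 0 ℕ.< p → u ℕ.< p → (∀ k → s ℕ.≤ k → k ℕ.≤ t → a k ℕ.< p) →
           ∀ k → k ℕ.≤ t → adjoin i u a s k ℕ.< p
adjoin-< i u a s t p>0 u<p a<p k k≤t with k ℕ.≟ i
... | yes _ = u<p
... | no  _ with k ℕ.<? s
...   | yes _   = p>0
...   | no  k≮s = a<p k (ℕP.≮⇒≥ k≮s) k≤t

[o+m]-o≡m : ∀ o m → (o ℤ.+ m) ℤ.- o ≡ m
[o+m]-o≡m = solve-∀

k≡o+[k-o] : ∀ k o → k ≡ o ℤ.+ (k ℤ.- o)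
k≡o+[k-o] = solve-∀

below-or-offset : ∀ k o → k ℤ.< o ⊎ ∃ λ m → k ≡ o ℤ.+ + m
below-or-offset k o with k ℤ.- o in k-o≡d
... | + m      = inj₂ (m , P.trans (k≡o+[k-o] k o) (P.cong (λ d → o ℤ.+ d) k-o≡d))
... | -[1+ m ] = inj₁ (P.subst (ℤ._< o) (P.sym (P.trans (k≡o+[k-o] k o) (P.cong (λ d → o ℤ.+ d) k-o≡d)))
                                 (P.subst (o ℤ.+ -[1+ m ] ℤ.<_) (ℤP.+-identityʳ o) (ℤP.+-monoʳ-< o ℤ.-<+)))

k<a+o⇒k-a<o : ∀ {k a o} → k ℤ.< a ℤ.+ o → k ℤ.- a ℤ.< o
k<a+o⇒k-a<o {k} {a} {o} k<a+o = P.subst (k ℤ.- a ℤ.<_) ([o+m]-o≡m a o) (ℤP.+-monoˡ-< (ℤ.- a) k<a+o)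

shifted-bound : ∀ {k a u N D} → k ℤ.* + D ℤ.≤ N ℤ.+ u ℤ.* + D → u ℤ.≤ a → (k ℤ.- a) ℤ.* + D ℤ.≤ N
shifted-bound {k} {a} {u} {N} {D} kD≤N+uD u≤a = begin
  (k ℤ.- a) ℤ.* + D                 ≡⟨ [k-a]d≡kd-ad k a (+ D) ⟩
  k ℤ.* + D ℤ.- a ℤ.* + D           ≤⟨ ℤP.+-mono-≤ kD≤N+uD (ℤP.neg-mono-≤ (ℤP.*-monoʳ-≤-nonNeg (+ D) u≤a)) ⟩
  (N ℤ.+ u ℤ.* + D) ℤ.- u ℤ.* + D   ≡⟨ [n+x]-x≡n N (u ℤ.* + D) ⟩
  N                                 ∎
  where
  open ℤP.≤-Reasoning
  [k-a]d≡kd-ad : ∀ k a d → (k ℤ.- a) ℤ.* d ≡ k ℤ.* d ℤ.- a ℤ.* d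
  [k-a]d≡kd-ad = solve-∀
  [n+x]-x≡n : ∀ n x → (n ℤ.+ x) ℤ.- x ≡ n
  [n+x]-x≡n = solve-∀

suc[o+d]≡o+[1+d] : ∀ o d → ℤ.suc (o ℤ.+ + d) ≡ o ℤ.+ + suc d
suc[o+d]≡o+[1+d] o d =
  P.trans (P.cong ℤ.suc (ℤP.+-comm o (+ d))) (P.trans (P.sym (ℤP.suc-+ d o)) (ℤP.+-comm (+ suc d) o))

n*v≤v : ∀ n v → 0 ℕ.< n → v ℤ.≤ + 0 → + n ℤ.* v ℤ.≤ v
n*v≤v n (+ zero)   _   _          = ℤP.≤-reflexive (ℤP.*-zeroʳ (+ n))
n*v≤v n (+ suc _)  _   (ℤ.+≤+ ())
n*v≤v n -[1+ u ]   n>0 _          = P.subst (+ n ℤ.* -[1+ u ] ℤ.≤_) (ℤP.*-identityˡ _)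
                                      (ℤP.*-monoʳ-≤-nonPos -[1+ u ] (ℤ.+≤+ n>0))

n*v<v : ∀ n v → 1 ℕ.< n → v ℤ.< + 0 → + n ℤ.* v ℤ.< v
n*v<v n (+ _)    _   (ℤ.+<+ ())
n*v<v n -[1+ u ] n>1 v<0 = ℤP.≤-<-trans (ℤP.*-monoʳ-≤-nonPos -[1+ u ] (ℤ.+≤+ n>1))
  (P.subst₂ ℤ._<_ (v+v≡2v -[1+ u ]) (ℤP.+-identityʳ -[1+ u ]) (ℤP.+-monoʳ-< -[1+ u ] v<0))
  where
  v+v≡2v : ∀ v → v ℤ.+ v ≡ + 2 ℤ.* v
  v+v≡2v = solve-∀

x≤x+y : ∀ {x y} → + 0 ℤ.≤ y → x ℤ.≤ x ℤ.+ y
x≤x+y {x} {y} y≥0 = P.subst (ℤ._≤ x ℤ.+ y) (ℤP.+-identityʳ x) (ℤP.+-monoʳ-≤ x y≥0)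

*-nonneg : ∀ {x y} → + 0 ℤ.≤ x → + 0 ℤ.≤ y → + 0 ℤ.≤ x ℤ.* y
*-nonneg {+ m} {+ k} _ _ = P.subst (+ 0 ℤ.≤_) (ℤP.pos-* m k) (ℤ.+≤+ z≤n)

negative-scale : ∀ {k N d d′} → N ℤ.< + 0 → d ℕ.≤ d′ → k ℤ.* + d ℤ.≤ N → k ℤ.* + d′ ℤ.≤ N
negative-scale {+ m}      {d = d} N<0 _ kd≤N =
  ⊥-elim (ℤP.<⇒≱ N<0 (ℤP.≤-trans (P.subst (+ 0 ℤ.≤_) (ℤP.pos-* m d) (ℤ.+≤+ z≤n)) kd≤N))
negative-scale { -[1+ u ]}        _   d≤d′ kd≤N = ℤP.≤-trans (ℤP.*-monoˡ-≤-nonPos -[1+ u ] (ℤ.+≤+ d≤d′)) kd≤N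

ΣZ-nonneg : ∀ f a b → (∀ j → a ℕ.≤ j → j ℕ.≤ b → + 0 ℤ.≤ f j) → + 0 ℤ.≤ ΣZ[ a , b ] f
ΣZ-nonneg f a b f≥0 = sumFromZ-nonneg (suc b ∸ a) (λ j j< → f≥0 (a ℕ.+ j) (ℕP.m≤m+n a j) (range-bound a b j j<))
  where
  sumFromZ-nonneg : ∀ l → (∀ j → j ℕ.< l → + 0 ℤ.≤ f (a ℕ.+ j)) → + 0 ℤ.≤ sumFromZ f a l
  sumFromZ-nonneg zero    _   = ℤP.≤-refl
  sumFromZ-nonneg (suc l) f≥0 = ℤP.+-mono-≤ (sumFromZ-nonneg l (λ j j<l → f≥0 j (ℕP.m<n⇒m<1+n j<l))) (f≥0 l ℕP.≤-refl)

module RingFacts {c ℓ} (R : CommutativeRing c ℓ) where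
  open CommutativeRing R
  open Over R
  open import Relation.Binary.Reasoning.Setoid setoid
  open import Algebra.Properties.Ring ring public
    using (-0#≈0#; x∙y⁻¹≈ε⇒x≈y; x≈y⇒x∙y⁻¹≈ε; x[y-z]≈xy-xz; [y-z]x≈yx-zx; -‿+-comm; +-cancelˡ)
  open import Algebra.Properties.Semiring.Exp semiring public
    using (_^_; ^-congˡ; ^-assocʳ)
  open import Algebra.Properties.CommutativeSemiring.Exp commutativeSemiring public
    using (^-distrib-*)
  open import Algebra.Properties.Monoid.Mult +-monoid public
    using (×-congʳ; ×-homo-+) renaming (_×_ to _×ₙ_)
  open import Algebra.Properties.Semiring.Mult semiring public
    using (×-assoc-*; ×1-homo-*)
  open import Tactic.RingSolver.NonReflective (ACR.fromCommutativeRing R (λ _ → nothing)) public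
    using (solve; _⊜_; _⊕_; _⊗_)

  sumF-cong : ∀ {f g} n → (∀ j → j ℕ.< n → f j ≈ g j) → sumF f n ≈ sumF g n
  sumF-cong zero    f≈g = refl
  sumF-cong (suc n) f≈g = +-cong (sumF-cong n (λ j j<n → f≈g j (ℕP.m<n⇒m<1+n j<n))) (f≈g n ℕP.≤-refl)

  sumF-zero : ∀ {f} n → (∀ j → j ℕ.< n → f j ≈ 0#) → sumF f n ≈ 0#
  sumF-zero zero    f≈0 = refl
  sumF-zero (suc n) f≈0 =
    trans (+-cong (sumF-zero n (λ j j<n → f≈0 j (ℕP.m<n⇒m<1+n j<n))) (f≈0 n ℕP.≤-refl)) (+-identityˡ 0#)

  sumF-+ : ∀ f g n → sumF (λ j → f j + g j) n ≈ sumF f n + sumF g n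
  sumF-+ f g zero    = sym (+-identityˡ 0#)
  sumF-+ f g (suc n) = trans (+-congʳ (sumF-+ f g n))
    (solve 4 (λ a b c d → ((a ⊕ b) ⊕ (c ⊕ d)) ⊜ ((a ⊕ c) ⊕ (b ⊕ d))) refl (sumF f n) (sumF g n) (f n) (g n))

  sumF-*ˡ : ∀ a f n → a * sumF f n ≈ sumF (λ j → a * f j) n
  sumF-*ˡ a f zero    = zeroʳ a
  sumF-*ˡ a f (suc n) = trans (distribˡ a (sumF f n) (f n)) (+-congʳ (sumF-*ˡ a f n))

  sumF-neg : ∀ f n → - sumF f n ≈ sumF (λ j → - f j) n
  sumF-neg f zero    = -0#≈0#
  sumF-neg f (suc n) = trans (sym (-‿+-comm (sumF f n) (f n))) (+-congʳ (sumF-neg f n))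

  sumF-head : ∀ f n → sumF f (suc n) ≈ f 0 + sumF (λ j → f (suc j)) n
  sumF-head f zero    = trans (+-identityˡ (f 0)) (sym (+-identityʳ (f 0)))
  sumF-head f (suc n) = trans (+-congʳ (sumF-head f n)) (+-assoc (f 0) _ _)

  sumF-++ : ∀ f m n → sumF f (m ℕ.+ n) ≈ sumF f m + sumF (λ j → f (m ℕ.+ j)) n
  sumF-++ f m zero = trans (reflexive (P.cong (sumF f) (ℕP.+-identityʳ m))) (sym (+-identityʳ _))
  sumF-++ f m (suc n) = begin
    sumF f (m ℕ.+ suc n)                                   ≡⟨ P.cong (sumF f) (ℕP.+-suc m n) ⟩
    sumF f (m ℕ.+ n) + f (m ℕ.+ n)                         ≈⟨ +-congʳ (sumF-++ f m n) ⟩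
    (sumF f m + sumF (λ j → f (m ℕ.+ j)) n) + f (m ℕ.+ n)  ≈⟨ +-assoc _ _ _ ⟩
    sumF f m + (sumF (λ j → f (m ℕ.+ j)) n + f (m ℕ.+ n))  ∎

  sumF-single : ∀ {f} n j₀ → j₀ ℕ.< n → (∀ j → j ℕ.< n → j ≢ j₀ → f j ≈ 0#) → sumF f n ≈ f j₀
  sumF-single (suc n) j₀ j₀<1+n f≈0 with j₀ ℕ.≟ n
  ... | yes P.refl =
    trans (+-congʳ (sumF-zero n (λ j j<n → f≈0 j (ℕP.m<n⇒m<1+n j<n) (ℕP.<⇒≢ j<n)))) (+-identityˡ _)
  ... | no j₀≢n = trans
    (+-cong (sumF-single n j₀ (ℕP.≤∧≢⇒< (ℕP.≤-pred j₀<1+n) j₀≢n) (λ j j<n → f≈0 j (ℕP.m<n⇒m<1+n j<n)))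
            (f≈0 n ℕP.≤-refl (λ n≡j₀ → j₀≢n (P.sym n≡j₀))))
    (+-identityʳ _)

  [x-r]+r≈x : ∀ x r → (x - r) + r ≈ x
  [x-r]+r≈x x r = trans (+-assoc x (- r) r) (trans (+-congˡ (-‿inverseˡ r)) (+-identityʳ x))

  x≈0⊎y≈0⇒x*y≈0 : ∀ {x y} → x ≈ 0# ⊎ y ≈ 0# → x * y ≈ 0#
  x≈0⊎y≈0⇒x*y≈0 {x} {y} (inj₁ x≈0) = trans (*-congʳ x≈0) (zeroˡ y)
  x≈0⊎y≈0⇒x*y≈0 {x} {y} (inj₂ y≈0) = trans (*-congˡ y≈0) (zeroʳ x)

  ΣF[_,_] : ℕ → ℕ → (ℕ → Carrier) → Carrier
  ΣF[ s , t ] f = sumF (λ j → f (s ℕ.+ j)) (suc t ∸ s)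

  ΣF-cong : ∀ {f g} s t → (∀ k → s ℕ.≤ k → k ℕ.≤ t → f k ≈ g k) → ΣF[ s , t ] f ≈ ΣF[ s , t ] g
  ΣF-cong s t f≈g = sumF-cong (suc t ∸ s) (λ j j< → f≈g (s ℕ.+ j) (ℕP.m≤m+n s j) (range-bound s t j j<))

  ΣF-*ʳ : ∀ f s t a → ΣF[ s , t ] f * a ≈ ΣF[ s , t ] (λ k → f k * a)
  ΣF-*ʳ f s t a = begin
    ΣF[ s , t ] f * a                   ≈⟨ *-comm _ a ⟩
    a * ΣF[ s , t ] f                   ≈⟨ sumF-*ˡ a _ (suc t ∸ s) ⟩
    ΣF[ s , t ] (λ k → a * f k)         ≈⟨ ΣF-cong s t (λ k _ _ → *-comm a (f k)) ⟩
    ΣF[ s , t ] (λ k → f k * a)         ∎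

  ΣF-- : ∀ f g s t → ΣF[ s , t ] (λ k → f k - g k) ≈ ΣF[ s , t ] f - ΣF[ s , t ] g
  ΣF-- f g s t = trans (sumF-+ _ _ (suc t ∸ s)) (+-congˡ (sym (sumF-neg _ (suc t ∸ s))))

  ΣF-singleton : ∀ f s → ΣF[ s , s ] f ≈ f s
  ΣF-singleton f s = begin
    ΣF[ s , s ] f                        ≡⟨ P.cong (sumF (λ j → f (s ℕ.+ j))) (ℕP.+-∸-assoc 1 (ℕP.≤-refl {s})) ⟩
    sumF (λ j → f (s ℕ.+ j)) (suc (s ∸ s)) ≡⟨ P.cong (λ l → sumF (λ j → f (s ℕ.+ j)) (suc l)) (ℕP.n∸n≡0 s) ⟩
    0# + f (s ℕ.+ 0)                     ≈⟨ +-identityˡ _ ⟩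
    f (s ℕ.+ 0)                          ≡⟨ P.cong f (ℕP.+-identityʳ s) ⟩
    f s                                  ∎

  ΣF-head-gap : ∀ f i s t → i ℕ.< s → s ℕ.≤ t → (∀ k → i ℕ.< k → k ℕ.< s → f k ≈ 0#) →
                ΣF[ i , t ] f ≈ f i + ΣF[ s , t ] f
  ΣF-head-gap f i s t i<s s≤t gap = begin
    sumF (λ j → f (i ℕ.+ j)) (suc t ∸ i)
      ≡⟨ P.cong (sumF (λ j → f (i ℕ.+ j))) (ℕP.+-∸-assoc 1 (ℕP.≤-trans (ℕP.<⇒≤ i<s) s≤t)) ⟩
    sumF (λ j → f (i ℕ.+ j)) (suc (t ∸ i))
      ≈⟨ sumF-head _ (t ∸ i) ⟩
    f (i ℕ.+ 0) + sumF g (t ∸ i)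
      ≡⟨ P.cong₂ (λ k l → f k + sumF g l) (ℕP.+-identityʳ i) (P.sym lengths) ⟩
    f i + sumF g ((s ∸ suc i) ℕ.+ (suc t ∸ s))
      ≈⟨ +-congˡ (sumF-++ g (s ∸ suc i) (suc t ∸ s)) ⟩
    f i + (sumF g (s ∸ suc i) + sumF (λ j → g ((s ∸ suc i) ℕ.+ j)) (suc t ∸ s))
      ≈⟨ +-congˡ (+-cong gap-sum (sumF-cong (suc t ∸ s) (λ j _ → reflexive (P.cong f (shift j))))) ⟩
    f i + (0# + ΣF[ s , t ] f)
      ≈⟨ +-congˡ (+-identityˡ _) ⟩
    f i + ΣF[ s , t ] f ∎
    where
    g : ℕ → Carrier
    g j = f (i ℕ.+ suc j)
    lengths : (s ∸ suc i) ℕ.+ (suc t ∸ s) ≡ t ∸ i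
    lengths = P.trans (P.sym (ℕP.+-∸-comm (suc t ∸ s) i<s))
                      (P.cong (_∸ suc i) (ℕP.m+[n∸m]≡n (ℕP.m≤n⇒m≤1+n s≤t)))
    shift : ∀ j → i ℕ.+ suc ((s ∸ suc i) ℕ.+ j) ≡ s ℕ.+ j
    shift j = P.trans (ℕP.+-suc i _)
      (P.trans (P.sym (ℕP.+-assoc (suc i) (s ∸ suc i) j)) (P.cong (ℕ._+ j) (ℕP.m+[n∸m]≡n i<s)))
    gap-sum : sumF g (s ∸ suc i) ≈ 0#
    gap-sum = sumF-zero (s ∸ suc i) (λ j j< →
      gap (i ℕ.+ suc j) (ℕP.m<m+n i (s≤s z≤n))
          (P.subst (ℕ._< s) (P.sym (ℕP.+-suc i j))
             (P.subst (suc (i ℕ.+ j) ℕ.<_) (ℕP.m+[n∸m]≡n i<s) (ℕP.+-monoʳ-< (suc i) j<))))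

  ΣF-adjoin : ∀ (L : ℕ → Carrier) i u a s t → i ℕ.< s → s ℕ.≤ t →
              ΣF[ i , t ] (λ k → natF (adjoin i u a s k) * L k) ≈ natF u * L i + ΣF[ s , t ] (λ k → natF (a k) * L k)
  ΣF-adjoin L i u a s t i<s s≤t = trans
    (ΣF-head-gap (λ k → natF (adjoin i u a s k) * L k) i s t i<s s≤t (λ k i<k k<s →
      trans (*-congʳ (reflexive (P.cong natF (adjoin-gap i u a s k i<k k<s)))) (zeroˡ (L k))))
    (+-cong (*-congʳ (reflexive (P.cong natF (adjoin-at i u a s))))
            (ΣF-cong {λ k → natF (adjoin i u a s k) * L k} s t (λ k s≤k _ →
              *-congʳ (reflexive (P.cong natF (adjoin-beyond i u a s k i<s s≤k))))))

  natF≈×1 : ∀ n → natF n ≈ n ×ₙ 1#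
  natF≈×1 zero    = refl
  natF≈×1 (suc n) = +-congˡ (natF≈×1 n)

  natF-+ : ∀ m n → natF (m ℕ.+ n) ≈ natF m + natF n
  natF-+ m n = trans (natF≈×1 (m ℕ.+ n))
    (trans (×-homo-+ 1# m n) (sym (+-cong (natF≈×1 m) (natF≈×1 n))))

  natF-* : ∀ m n → natF (m ℕ.* n) ≈ natF m * natF n
  natF-* m n = trans (natF≈×1 (m ℕ.* n))
    (trans (×1-homo-* m n) (sym (*-cong (natF≈×1 m) (natF≈×1 n))))

  natF-1 : natF 1 ≈ 1#
  natF-1 = +-identityʳ 1#

  1^n≈1 : ∀ n → 1# ^ n ≈ 1#
  1^n≈1 zero    = refl
  1^n≈1 (suc n) = trans (*-identityˡ _) (1^n≈1 n)

  ×ₙ≈natF* : ∀ n x → n ×ₙ x ≈ natF n * x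
  ×ₙ≈natF* n x = begin
    n ×ₙ x          ≈⟨ ×-congʳ n (*-identityˡ x) ⟨
    n ×ₙ (1# * x)   ≈⟨ ×-assoc-* n 1# x ⟨
    (n ×ₙ 1#) * x   ≈⟨ *-congʳ (natF≈×1 n) ⟨
    natF n * x      ∎

  module _ (x y : Carrier) where
    open import Algebra.Properties.Semiring.Binomial semiring using (binomialTerm)
    open import Algebra.Properties.CommutativeSemiring.Binomial commutativeSemiring using (theorem)
    open import Algebra.Properties.Monoid.Sum +-monoid using (sum; sum-init-last; sum-cong-≋; sum-replicate-zero)

    private
      binomialTerm-at : ∀ n (k : Fin (suc n)) j → toℕ k ≡ j →
                        binomialTerm x y n k ≈ (n C j) ×ₙ (x ^ j * y ^ (n ∸ j))
      binomialTerm-at n k j P.refl = refl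

    freshman's-dream : ∀ n → 1 ℕ.< n → (∀ k → 0 ℕ.< k → k ℕ.< n → ∀ z → (n C k) ×ₙ z ≈ 0#) →
                       (x + y) ^ n ≈ x ^ n + y ^ n
    freshman's-dream (suc zero) (s≤s ())
    freshman's-dream n@(suc (suc m)) _ middle≈0 = begin
      (x + y) ^ n                                               ≈⟨ theorem n x y ⟩
      sum t                                                     ≈⟨ +-congˡ (sum-init-last (Vec.tail t)) ⟩
      t Fin.zero + (sum (Vec.init (Vec.tail t)) + Vec.last (Vec.tail t)) ≈⟨ +-cong first (+-cong middle last) ⟩
      y ^ n + (0# + x ^ n)                                      ≈⟨ +-congˡ (+-identityˡ _) ⟩
      y ^ n + x ^ n                                             ≈⟨ +-comm _ _ ⟩
      x ^ n + y ^ n                                             ∎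
      where
      t = binomialTerm x y n
      first : t Fin.zero ≈ y ^ n
      first = trans (+-identityʳ _) (*-identityˡ _)
      last : Vec.last (Vec.tail t) ≈ x ^ n
      last = begin
        Vec.last (Vec.tail t)                 ≈⟨ binomialTerm-at n _ n (P.cong suc (FinP.toℕ-fromℕ (suc m))) ⟩
        (n C n) ×ₙ (x ^ n * y ^ (n ∸ n))      ≡⟨ P.cong₂ (λ c e → c ×ₙ (x ^ n * y ^ e)) (nCn≡1 n) (ℕP.n∸n≡0 n) ⟩
        1 ×ₙ (x ^ n * 1#)                     ≈⟨ trans (+-identityʳ _) (*-identityʳ _) ⟩
        x ^ n                                 ∎
      middle : sum (Vec.init (Vec.tail t)) ≈ 0#
      middle = trans (sum-cong-≋ (λ i →
          trans (binomialTerm-at n _ (suc (toℕ i)) (P.cong suc (FinP.toℕ-inject₁ i)))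
                (middle≈0 (suc (toℕ i)) ℕP.0<1+n (s≤s (FinP.toℕ<n i)) _)))
        (sum-replicate-zero (suc m))

  0^n≈0 : ∀ n → 0 ℕ.< n → 0# ^ n ≈ 0#
  0^n≈0 (suc n) _ = zeroˡ _

  additive-power-ΣF : ∀ q → 0 ℕ.< q → (∀ x y → (x + y) ^ q ≈ x ^ q + y ^ q) → (∀ a → natF a ^ q ≈ natF a) →
                      ∀ (a : ℕ → ℕ) (g : ℕ → Carrier) s t →
                      ΣF[ s , t ] (λ k → natF (a k) * g k) ^ q ≈ ΣF[ s , t ] (λ k → natF (a k) * g k ^ q)
  additive-power-ΣF q q>0 additive fixes a g s t =
    trans (sumF-power (λ j → natF (a (s ℕ.+ j)) * g (s ℕ.+ j)) (suc t ∸ s))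
    (ΣF-cong s t (λ k _ _ → trans (^-distrib-* (natF (a k)) (g k) q) (*-congʳ (fixes (a k)))))
    where
    sumF-power : ∀ f N → sumF f N ^ q ≈ sumF (λ j → f j ^ q) N
    sumF-power f zero    = 0^n≈0 q q>0
    sumF-power f (suc N) = trans (additive _ _) (+-congʳ (sumF-power f N))

module CharacteristicFacts {c ℓ} (R : CommutativeRing c ℓ) (p : ℕ) (prime-p : Prime p) (char-p : Over.HasChar R p) where
  open CommutativeRing R
  open Over R
  open RingFacts R
  open import Relation.Binary.Reasoning.Setoid setoid

  p>0 : 0 ℕ.< p
  p>0 = prime>0 prime-p

  p^e>0 : ∀ e → 0 ℕ.< p ℕ.^ e
  p^e>0 e = ℕP.m^n>0 p ⦃ ℕ.>-nonZero p>0 ⦄ e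

  natF-multiple : ∀ q → natF (q ℕ.* p) ≈ 0#
  natF-multiple q = trans (natF-* q p) (trans (*-congˡ char-p) (zeroʳ _))

  frobenius : ∀ x y → (x + y) ^ p ≈ x ^ p + y ^ p
  frobenius x y = freshman's-dream x y p (prime>1 prime-p) middle≈0
    where
    middle≈0 : ∀ k → 0 ℕ.< k → k ℕ.< p → ∀ z → (p C k) ×ₙ z ≈ 0#
    middle≈0 k 0<k k<p z with prime∣pCk prime-p k 0<k k<p
    ... | divides q pCk≡q*p = begin
      (p C k) ×ₙ z         ≈⟨ ×ₙ≈natF* (p C k) z ⟩
      natF (p C k) * z     ≡⟨ P.cong (λ m → natF m * z) pCk≡q*p ⟩
      natF (q ℕ.* p) * z   ≈⟨ *-congʳ (natF-multiple q) ⟩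
      0# * z               ≈⟨ zeroˡ z ⟩
      0#                   ∎

  fermat : ∀ a → natF a ^ p ≈ natF a
  fermat zero    = 0^n≈0 p p>0
  fermat (suc a) = trans (frobenius 1# (natF a)) (+-cong (1^n≈1 p) (fermat a))

  frobenius^ : ∀ e x y → (x + y) ^ (p ℕ.^ e) ≈ x ^ (p ℕ.^ e) + y ^ (p ℕ.^ e)
  frobenius^ zero    x y = trans (*-identityʳ _) (sym (+-cong (*-identityʳ x) (*-identityʳ y)))
  frobenius^ (suc e) x y = begin
    (x + y) ^ (p ℕ.* p ℕ.^ e)                   ≈⟨ ^-assocʳ (x + y) p (p ℕ.^ e) ⟨
    ((x + y) ^ p) ^ (p ℕ.^ e)                   ≈⟨ ^-congˡ (p ℕ.^ e) (frobenius x y) ⟩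
    (x ^ p + y ^ p) ^ (p ℕ.^ e)                 ≈⟨ frobenius^ e (x ^ p) (y ^ p) ⟩
    (x ^ p) ^ (p ℕ.^ e) + (y ^ p) ^ (p ℕ.^ e)   ≈⟨ +-cong (^-assocʳ x p (p ℕ.^ e)) (^-assocʳ y p (p ℕ.^ e)) ⟩
    x ^ (p ℕ.* p ℕ.^ e) + y ^ (p ℕ.* p ℕ.^ e)   ∎

  fermat^ : ∀ e a → natF a ^ (p ℕ.^ e) ≈ natF a
  fermat^ zero    a = *-identityʳ _
  fermat^ (suc e) a =
    trans (sym (^-assocʳ (natF a) p (p ℕ.^ e))) (trans (^-congˡ (p ℕ.^ e) (fermat a)) (fermat^ e a))

  frobenius-ΣF : ∀ (a : ℕ → ℕ) (g : ℕ → Carrier) s t →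
                 ΣF[ s , t ] (λ k → natF (a k) * g k) ^ p ≈ ΣF[ s , t ] (λ k → natF (a k) * g k ^ p)
  frobenius-ΣF = additive-power-ΣF p p>0 frobenius fermat

  frobenius^-ΣF : ∀ e (a : ℕ → ℕ) (g : ℕ → Carrier) s t →
                  ΣF[ s , t ] (λ k → natF (a k) * g k) ^ (p ℕ.^ e) ≈ ΣF[ s , t ] (λ k → natF (a k) * g k ^ (p ℕ.^ e))
  frobenius^-ΣF e = additive-power-ΣF (p ℕ.^ e) (p^e>0 e) (frobenius^ e) (fermat^ e)

  𝔽ₚ-negation : ∀ a → a ℕ.< p → ∃ λ a′ → a′ ℕ.< p × natF a′ + natF a ≈ 0#
  𝔽ₚ-negation zero    _   = 0 , p>0 , +-identityˡ 0#
  𝔽ₚ-negation (suc a) a<p = p ∸ suc a , ℕP.∸-monoʳ-< {p} {suc a} {0} ℕP.0<1+n (ℕP.<⇒≤ a<p) , (begin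
    natF (p ∸ suc a) + natF (suc a)   ≈⟨ natF-+ (p ∸ suc a) (suc a) ⟨
    natF (p ∸ suc a ℕ.+ suc a)        ≡⟨ P.cong natF (ℕP.m∸n+n≡m (ℕP.<⇒≤ a<p)) ⟩
    natF p                            ≈⟨ char-p ⟩
    0#                                ∎)

module FieldFacts {c ℓ} (R : CommutativeRing c ℓ) (field-R : Over.IsField R) where
  open CommutativeRing R
  open Over R
  open RingFacts R
  open import Relation.Binary.Reasoning.Setoid setoid

  1≉0 : ¬ (1# ≈ 0#)
  1≉0 1≈0 = proj₁ field-R (sym 1≈0)

  x≉0∧x*y≈0⇒y≈0 : ∀ {x y} → ¬ (x ≈ 0#) → x * y ≈ 0# → y ≈ 0#
  x≉0∧x*y≈0⇒y≈0 {x} {y} x≉0 xy≈0 with proj₂ field-R x x≉0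
  ... | x⁻¹ , xx⁻¹≈1 = begin
    y               ≈⟨ *-identityˡ y ⟨
    1# * y          ≈⟨ *-congʳ (trans (sym xx⁻¹≈1) (*-comm x x⁻¹)) ⟩
    (x⁻¹ * x) * y   ≈⟨ *-assoc x⁻¹ x y ⟩
    x⁻¹ * (x * y)   ≈⟨ *-congˡ xy≈0 ⟩
    x⁻¹ * 0#        ≈⟨ zeroʳ x⁻¹ ⟩
    0#              ∎

  y≉0∧x*y≈0⇒x≈0 : ∀ {x y} → ¬ (y ≈ 0#) → x * y ≈ 0# → x ≈ 0#
  y≉0∧x*y≈0⇒x≈0 {x} {y} y≉0 xy≈0 = x≉0∧x*y≈0⇒y≈0 y≉0 (trans (*-comm y x) xy≈0)

  x≉0∧y≉0⇒x*y≉0 : ∀ {x y} → ¬ (x ≈ 0#) → ¬ (y ≈ 0#) → ¬ (x * y ≈ 0#)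
  x≉0∧y≉0⇒x*y≉0 x≉0 y≉0 xy≈0 = y≉0 (x≉0∧x*y≈0⇒y≈0 x≉0 xy≈0)

  x≉0⇒x^n≉0 : ∀ {x} → ¬ (x ≈ 0#) → ∀ n → ¬ (x ^ n ≈ 0#)
  x≉0⇒x^n≉0 x≉0 zero    = 1≉0
  x≉0⇒x^n≉0 x≉0 (suc n) = x≉0∧y≉0⇒x*y≉0 x≉0 (x≉0⇒x^n≉0 x≉0 n)

  *-cancelʳ-≉0 : ∀ {x y z} → ¬ (z ≈ 0#) → x * z ≈ y * z → x ≈ y
  *-cancelʳ-≉0 {x} {y} {z} z≉0 xz≈yz =
    x∙y⁻¹≈ε⇒x≈y x y (y≉0∧x*y≈0⇒x≈0 z≉0 (trans ([y-z]x≈yx-zx z x y) (x≈y⇒x∙y⁻¹≈ε xz≈yz)))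

  -- f agrees with a monic polynomial function of degree d, given in Horner form.
  Monic : ℕ → (Carrier → Carrier) → Set (c ⊔ ℓ)
  Monic zero    f = ∀ x → f x ≈ 1#
  Monic (suc d) f = Σ (Carrier → Carrier) λ g → Σ Carrier λ a → Monic d g × (∀ x → f x ≈ x * g x + a)

  monic-^ : ∀ d → Monic d (_^ d)
  monic-^ zero    _ = refl
  monic-^ (suc d) = (_^ d) , 0# , monic-^ d , λ _ → sym (+-identityʳ _)

  monic-^-id : ∀ d → Monic (suc (suc d)) (λ x → x ^ suc (suc d) - x)
  monic-^-id d = (λ x → x ^ suc d - 1#) , 0# , ((_^ d) , - 1# , monic-^ d , λ _ → refl) , λ x → begin
    x ^ suc (suc d) - x          ≈⟨ +-congˡ (-‿cong (*-identityʳ x)) ⟨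
    x * x ^ suc d - x * 1#       ≈⟨ x[y-z]≈xy-xz x _ 1# ⟨
    x * (x ^ suc d - 1#)         ≈⟨ +-identityʳ _ ⟨
    x * (x ^ suc d - 1#) + 0#    ∎

  monic-factor : ∀ {d f} → Monic (suc d) f → ∀ r →
                 Σ (Carrier → Carrier) λ h → Monic d h × (∀ x → f x ≈ (x - r) * h x + f r)
  monic-factor {zero} {f} (g , a , g≈1 , f≈) r = g , g≈1 , λ x → begin
    f x                                ≈⟨ f≈ x ⟩
    x * g x + a                        ≈⟨ +-congʳ (*-cong (sym ([x-r]+r≈x x r)) (g≈1 x)) ⟩
    ((x - r) + r) * 1# + a             ≈⟨ solve 4 (λ y r a u → ((y ⊕ r) ⊗ u ⊕ a) ⊜ (y ⊗ u ⊕ (r ⊗ u ⊕ a)))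
                                                  refl (x - r) r a 1# ⟩
    (x - r) * 1# + (r * 1# + a)        ≈⟨ +-cong (*-congˡ (g≈1 x)) (+-congʳ (*-congˡ (g≈1 r))) ⟨
    (x - r) * g x + (r * g r + a)      ≈⟨ +-congˡ (f≈ r) ⟨
    (x - r) * g x + f r                ∎
  monic-factor {suc d} {f} (g , a , monic-g , f≈) r with monic-factor monic-g r
  ... | h , monic-h , g≈ = (λ x → x * h x + g r) , (h , g r , monic-h , λ _ → refl) , λ x → begin
    f x                                                  ≈⟨ f≈ x ⟩
    x * g x + a                                          ≈⟨ +-congʳ (*-cong (sym ([x-r]+r≈x x r)) (g≈ x)) ⟩
    ((x - r) + r) * ((x - r) * h x + g r) + a
      ≈⟨ solve 5 (λ y r hx gr a → ((y ⊕ r) ⊗ (y ⊗ hx ⊕ gr) ⊕ a) ⊜ (y ⊗ ((y ⊕ r) ⊗ hx ⊕ gr) ⊕ (r ⊗ gr ⊕ a)))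
                 refl (x - r) r (h x) (g r) a ⟩
    (x - r) * (((x - r) + r) * h x + g r) + (r * g r + a)
      ≈⟨ +-cong (*-congˡ (+-congʳ (*-congʳ ([x-r]+r≈x x r)))) (sym (f≈ r)) ⟩
    (x - r) * (x * h x + g r) + f r ∎

  monic-root-bound : ∀ d {f} → Monic d f → (r : ℕ → Carrier) → (∀ i → i ℕ.≤ d → f (r i) ≈ 0#) →
                     ¬ (∀ i j → i ℕ.≤ d → j ℕ.≤ d → i ≢ j → ¬ (r i ≈ r j))
  monic-root-bound zero    monic-f r roots _        = 1≉0 (trans (sym (monic-f (r 0))) (roots 0 z≤n))
  monic-root-bound (suc d) monic-f r roots distinct with monic-factor monic-f (r 0)
  ... | h , monic-h , f≈ = monic-root-bound d monic-h (λ i → r (suc i)) roots-h distinct-h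
    where
    roots-h : ∀ i → i ℕ.≤ d → h (r (suc i)) ≈ 0#
    roots-h i i≤d = x≉0∧x*y≈0⇒y≈0
      (λ r₁₊ᵢ-r₀≈0 → distinct (suc i) 0 (s≤s i≤d) z≤n (λ ()) (x∙y⁻¹≈ε⇒x≈y _ _ r₁₊ᵢ-r₀≈0))
      (trans (sym (+-identityʳ _)) (trans (+-congˡ (sym (roots 0 z≤n)))
        (trans (sym (f≈ (r (suc i)))) (roots (suc i) (s≤s i≤d)))))
    distinct-h : ∀ i j → i ℕ.≤ d → j ℕ.≤ d → i ≢ j → ¬ (r (suc i) ≈ r (suc j))
    distinct-h i j i≤d j≤d i≢j = distinct (suc i) (suc j) (s≤s i≤d) (s≤s j≤d) (λ e → i≢j (ℕP.suc-injective e))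

module PrimeFieldFacts {c ℓ} (R : CommutativeRing c ℓ) (field-R : Over.IsField R)
                       (p : ℕ) (prime-p : Prime p) (char-p : Over.HasChar R p) where
  open CommutativeRing R
  open Over R
  open RingFacts R
  open FieldFacts R field-R
  open CharacteristicFacts R p prime-p char-p
  open import Relation.Binary.Reasoning.Setoid setoid

  natF≉0 : ∀ k → 0 ℕ.< k → k ℕ.< p → ¬ (natF k ≈ 0#)
  natF≉0 (suc k) _ k<p natF[k]≈0 with coprime-Bézout (prime⇒coprime prime-p k<p)
  ... | Bézout.+- x y 1+y*k≡x*p = 1≉0 (begin
    1#                          ≈⟨ +-identityʳ 1# ⟨
    1# + 0#                     ≈⟨ +-congˡ (trans (natF-* y (suc k)) (trans (*-congˡ natF[k]≈0) (zeroʳ _))) ⟨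
    natF (1 ℕ.+ y ℕ.* suc k)    ≡⟨ P.cong natF 1+y*k≡x*p ⟩
    natF (x ℕ.* p)              ≈⟨ natF-multiple x ⟩
    0#                          ∎)
  ... | Bézout.-+ x y 1+x*p≡y*k = 1≉0 (begin
    1#                          ≈⟨ +-identityʳ 1# ⟨
    1# + 0#                     ≈⟨ +-congˡ (natF-multiple x) ⟨
    natF (1 ℕ.+ x ℕ.* p)        ≡⟨ P.cong natF 1+x*p≡y*k ⟩
    natF (y ℕ.* suc k)          ≈⟨ trans (natF-* y (suc k)) (trans (*-congˡ natF[k]≈0) (zeroʳ _)) ⟩
    0#                          ∎)

  natF≈0⇒≡0 : ∀ a → a ℕ.< p → natF a ≈ 0# → a ≡ 0
  natF≈0⇒≡0 zero    _   _ = P.refl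
  natF≈0⇒≡0 (suc a) a<p natF[a]≈0 = ⊥-elim (natF≉0 (suc a) ℕP.0<1+n a<p natF[a]≈0)

  natF-<⇒≉ : ∀ {m n} → m ℕ.< n → n ℕ.< p → ¬ (natF n ≈ natF m)
  natF-<⇒≉ {m} {n} m<n n<p natF[n]≈natF[m] =
    natF≉0 (n ∸ m) (ℕP.m<n⇒0<n∸m m<n) (ℕP.≤-<-trans (ℕP.m∸n≤m n m) n<p) (+-cancelˡ (natF m) _ _ (begin
      natF m + natF (n ∸ m)   ≈⟨ natF-+ m (n ∸ m) ⟨
      natF (m ℕ.+ (n ∸ m))    ≡⟨ P.cong natF (ℕP.m+[n∸m]≡n (ℕP.<⇒≤ m<n)) ⟩
      natF n                  ≈⟨ natF[n]≈natF[m] ⟩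
      natF m                  ≈⟨ +-identityʳ _ ⟨
      natF m + 0#             ∎))

  natF-injective : ∀ a b → a ℕ.< p → b ℕ.< p → natF a ≈ natF b → a ≡ b
  natF-injective a b a<p b<p natF[a]≈natF[b] with ℕP.<-cmp a b
  ... | tri≈ _ a≡b _ = a≡b
  ... | tri< a<b _ _ = ⊥-elim (natF-<⇒≉ a<b b<p (sym natF[a]≈natF[b]))
  ... | tri> _ _ b<a = ⊥-elim (natF-<⇒≉ b<a a<p natF[a]≈natF[b])

  fixed-by-frobenius⇒∈𝔽ₚ : ∀ x → x ^ p ≈ x → ¬ ¬ (∃ λ a → a ℕ.< p × x ≈ natF a)
  fixed-by-frobenius⇒∈𝔽ₚ x x^p≈x x∉𝔽ₚ = monic-root-bound p monic-℘ roots ℘[root]≈0 distinct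
    where
    p≡2+d : p ≡ suc (suc (p ∸ 2))
    p≡2+d = P.sym (ℕP.m+[n∸m]≡n (prime>1 prime-p))
    monic-℘ : Monic p (λ y → y ^ p - y)
    monic-℘ = P.subst (λ k → Monic k (λ y → y ^ k - y)) (P.sym p≡2+d) (monic-^-id (p ∸ 2))
    roots : ℕ → Carrier
    roots zero    = x
    roots (suc a) = natF a
    ℘[root]≈0 : ∀ i → i ℕ.≤ p → roots i ^ p - roots i ≈ 0#
    ℘[root]≈0 zero    _ = x≈y⇒x∙y⁻¹≈ε x^p≈x
    ℘[root]≈0 (suc a) _ = x≈y⇒x∙y⁻¹≈ε (fermat a)
    distinct : ∀ i j → i ℕ.≤ p → j ℕ.≤ p → i ≢ j → ¬ (roots i ≈ roots j)
    distinct zero    zero    _   _   i≢j _ = i≢j P.refl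
    distinct zero    (suc b) _   b<p _   x≈b = x∉𝔽ₚ (b , b<p , x≈b)
    distinct (suc a) zero    a<p _   _   a≈x = x∉𝔽ₚ (a , a<p , sym a≈x)
    distinct (suc a) (suc b) a<p b<p i≢j a≈b = i≢j (P.cong suc (natF-injective a b a<p b<p a≈b))

module LaurentFacts {c ℓ} (R : CommutativeRing c ℓ) where
  open CommutativeRing R
  open Over R
  open RingFacts R
  open import Relation.Binary.Reasoning.Setoid setoid

  coef-ord+ : ∀ x m → coef x (ord x ℤ.+ + m) ≡ cf x m
  coef-ord+ x m rewrite [o+m]-o≡m (ord x) (+ m) = P.refl

  coef-below-ord : ∀ x k → k ℤ.< ord x → coef x k ≈ 0#
  coef-below-ord x k k<o with k ℤ.- ord x in k-o≡d
  ... | -[1+ m ] = refl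
  ... | + m      = ⊥-elim (ℤP.<⇒≱ k<o (P.subst (ord x ℤ.≤_)
                     (P.sym (P.trans (k≡o+[k-o] k (ord x)) (P.cong (λ d → ord x ℤ.+ d) k-o≡d)))
                     (ℤP.i≤i+j (ord x) (+ m))))

  coef-+L : ∀ x y k → coef (x +L y) k ≈ coef x k + coef y k
  coef-+L x y k with below-or-offset k (ord x ℤ.⊓ ord y)
  ... | inj₂ (m , P.refl) = reflexive (coef-ord+ (x +L y) m)
  ... | inj₁ k<o          = begin
    coef (x +L y) k       ≈⟨ coef-below-ord (x +L y) k k<o ⟩
    0#                    ≈⟨ +-identityʳ 0# ⟨
    0# + 0#               ≈⟨ +-cong (coef-below-ord x k (ℤP.<-≤-trans k<o (ℤP.i⊓j≤i (ord x) (ord y))))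
                                    (coef-below-ord y k (ℤP.<-≤-trans k<o (ℤP.i⊓j≤j (ord x) (ord y)))) ⟨
    coef x k + coef y k   ∎

  coef--L : ∀ x k → coef (-L x) k ≈ - coef x k
  coef--L x k with below-or-offset k (ord x)
  ... | inj₂ (m , P.refl) = trans (reflexive (coef-ord+ (-L x) m)) (-‿cong (reflexive (P.sym (coef-ord+ x m))))
  ... | inj₁ k<o          =
    trans (coef-below-ord (-L x) k k<o) (sym (trans (-‿cong (coef-below-ord x k k<o)) -0#≈0#))

  coef-L- : ∀ x y k → coef (x -L y) k ≈ coef x k - coef y k
  coef-L- x y k = trans (coef-+L x (-L y) k) (+-congˡ (coef--L y k))

  coef-·L : ∀ a x k → coef (a ·L x) k ≈ a * coef x k
  coef-·L a x k with below-or-offset k (ord x)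
  ... | inj₂ (m , P.refl) = trans (reflexive (coef-ord+ (a ·L x) m)) (*-congˡ (reflexive (P.sym (coef-ord+ x m))))
  ... | inj₁ k<o          =
    trans (coef-below-ord (a ·L x) k k<o) (sym (trans (*-congˡ (coef-below-ord x k k<o)) (zeroʳ a)))

  coef-0L : ∀ k → coef 0L k ≈ 0#
  coef-0L k with below-or-offset k (+ 0)
  ... | inj₂ (m , P.refl) = reflexive (coef-ord+ 0L m)
  ... | inj₁ k<0          = coef-below-ord 0L k k<0

  coef-ΣL : ∀ a b f k → coef (ΣL[ a , b ] f) k ≈ ΣF[ a , b ] (λ j → coef (f j) k)
  coef-ΣL a b f k = coef-sumFromL (suc b ∸ a)
    where
    coef-sumFromL : ∀ l → coef (sumFromL f a l) k ≈ sumF (λ j → coef (f (a ℕ.+ j)) k) l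
    coef-sumFromL zero    = coef-0L k
    coef-sumFromL (suc l) = trans (coef-+L _ _ k) (+-congʳ (coef-sumFromL l))

  ≈L-sym : ∀ {x y} → x ≈L y → y ≈L x
  ≈L-sym x≈y k = sym (x≈y k)

  ValGe-resp : ∀ {x y u} → x ≈L y → ValGe x u → ValGe y u
  ValGe-resp x≈y x≥u k k<u = trans (sym (x≈y k)) (x≥u k k<u)

  HasVal-resp : ∀ {x y w} → x ≈L y → HasVal x w → HasVal y w
  HasVal-resp {w = w} x≈y (lead≉0 , x≥w) = (λ lead≈0 → lead≉0 (trans (x≈y w) lead≈0)) , ValGe-resp x≈y x≥w

  ValGe-mono : ∀ {x u u′} → u′ ℤ.≤ u → ValGe x u → ValGe x u′
  ValGe-mono u′≤u x≥u k k<u′ = x≥u k (ℤP.<-≤-trans k<u′ u′≤u)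

  ValGe-ord : ∀ x → ValGe x (ord x)
  ValGe-ord = coef-below-ord

  ValGe-+L : ∀ {x y u} → ValGe x u → ValGe y u → ValGe (x +L y) u
  ValGe-+L {x} {y} x≥u y≥u k k<u = trans (coef-+L x y k) (trans (+-cong (x≥u k k<u) (y≥u k k<u)) (+-identityʳ 0#))

  ValGe-L- : ∀ {x y u} → ValGe x u → ValGe y u → ValGe (x -L y) u
  ValGe-L- {x} {y} x≥u y≥u = ValGe-+L x≥u (λ k k<u → trans (coef--L y k) (trans (-‿cong (y≥u k k<u)) -0#≈0#))

  ValGe-·L : ∀ {a x u} → ValGe x u → ValGe (a ·L x) u
  ValGe-·L {a} {x} x≥u k k<u = trans (coef-·L a x k) (trans (*-congˡ (x≥u k k<u)) (zeroʳ a))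

  ValGe-ΣL : ∀ {a b f u} → (∀ j → a ℕ.≤ j → j ℕ.≤ b → ValGe (f j) u) → ValGe (ΣL[ a , b ] f) u
  ValGe-ΣL {a} {b} {f} f≥u k k<u =
    trans (coef-ΣL a b f k) (sumF-zero (suc b ∸ a) (λ j j< → f≥u (a ℕ.+ j) (ℕP.m≤m+n a j) (range-bound a b j j<) k k<u))

  ValGe-suc : ∀ {x u} → ValGe x u → coef x u ≈ 0# → ValGe x (u ℤ.+ + 1)
  ValGe-suc {x} {u} x≥u xᵤ≈0 k k<u+1 with ℤP.<-cmp k u
  ... | tri< k<u _ _  = x≥u k k<u
  ... | tri≈ _ P.refl _ = xᵤ≈0
  ... | tri> _ _ u<k  = ⊥-elim (ℤP.<⇒≱ k<u+1 (P.subst (ℤ._≤ k) (ℤP.+-comm (+ 1) u) (ℤP.i<j⇒suc[i]≤j u<k)))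

  ValGtFrac-L- : ∀ {x y N D} → ValGtFrac x N D → ValGtFrac y N D → ValGtFrac (x -L y) N D
  ValGtFrac-L- {x} {y} x>N/D y>N/D k kD≤N = trans (coef-L- x y k)
    (trans (+-cong (x>N/D k kD≤N) (-‿cong (y>N/D k kD≤N))) (trans (+-congˡ -0#≈0#) (+-identityʳ 0#)))

  ValGtFrac-weaken : ∀ {x N N′ D D′} → N ℤ.< + 0 → D ℕ.≤ D′ → N ℤ.≤ N′ →
                     ValGtFrac x N′ D′ → ValGtFrac x N D
  ValGtFrac-weaken N<0 D≤D′ N≤N′ x>N′/D′ k kD≤N =
    x>N′/D′ k (ℤP.≤-trans (negative-scale {k} N<0 D≤D′ kD≤N) N≤N′)

  ValGtFrac-mono : ∀ {x N N′ D} → N′ ℤ.≤ N → ValGtFrac x N D → ValGtFrac x N′ D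
  ValGtFrac-mono N′≤N x>N/D k kD≤N′ = x>N/D k (ℤP.≤-trans kD≤N′ N′≤N)

  coef-*L-as-sum : ∀ x y M → coef (x *L y) ((ord x ℤ.+ ord y) ℤ.+ + M) ≈
                   sumF (λ j → coef x (ord x ℤ.+ + j) * coef y (((ord x ℤ.+ ord y) ℤ.+ + M) ℤ.- (ord x ℤ.+ + j))) (suc M)
  coef-*L-as-sum x y M = trans (reflexive (coef-ord+ (x *L y) M)) (sumF-cong (suc M) (λ j j≤M →
    reflexive (P.sym (P.cong₂ _*_ (coef-ord+ x j)
      (P.trans (P.cong (coef y) (index (ord x) (ord y) (ℕP.≤-pred j≤M))) (coef-ord+ y (M ∸ j)))))))
    where
    index : ∀ ox oy {j} → j ℕ.≤ M → ((ox ℤ.+ oy) ℤ.+ + M) ℤ.- (ox ℤ.+ + j) ≡ oy ℤ.+ + (M ∸ j)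
    index ox oy {j} j≤M = P.trans (regroup ox oy (+ M) (+ j))
      (P.cong (λ d → oy ℤ.+ d) (P.trans (ℤP.[+m]-[+n]≡m⊖n M j) (ℤP.⊖-≥ j≤M)))
      where
      regroup : ∀ ox oy m j → ((ox ℤ.+ oy) ℤ.+ m) ℤ.- (ox ℤ.+ j) ≡ oy ℤ.+ (m ℤ.- j)
      regroup = solve-∀

  coef-*L≈0 : ∀ x y k → (∀ a → coef x a ≈ 0# ⊎ coef y (k ℤ.- a) ≈ 0#) → coef (x *L y) k ≈ 0#
  coef-*L≈0 x y k factor≈0 with below-or-offset k (ord x ℤ.+ ord y)
  ... | inj₁ k<o          = coef-below-ord (x *L y) k k<o
  ... | inj₂ (M , P.refl) = trans (coef-*L-as-sum x y M)
    (sumF-zero (suc M) (λ j _ → x≈0⊎y≈0⇒x*y≈0 (factor≈0 (ord x ℤ.+ + j))))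

  private
    vanishing-single-term : ∀ x y k a₀ → (∀ a → a ≢ a₀ → coef x a ≈ 0# ⊎ coef y (k ℤ.- a) ≈ 0#) →
                 coef x a₀ ≈ 0# ⊎ coef y (k ℤ.- a₀) ≈ 0# → coef (x *L y) k ≈ coef x a₀ * coef y (k ℤ.- a₀)
    vanishing-single-term x y k a₀ others≈0 this≈0 = trans (coef-*L≈0 x y k all≈0) (sym (x≈0⊎y≈0⇒x*y≈0 this≈0))
      where
      all≈0 : ∀ a → coef x a ≈ 0# ⊎ coef y (k ℤ.- a) ≈ 0#
      all≈0 a with a ℤ.≟ a₀
      ... | yes P.refl = this≈0
      ... | no a≢a₀    = others≈0 a a≢a₀

  coef-*L≈single : ∀ x y k a₀ → (∀ a → a ≢ a₀ → coef x a ≈ 0# ⊎ coef y (k ℤ.- a) ≈ 0#) →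
                   coef (x *L y) k ≈ coef x a₀ * coef y (k ℤ.- a₀)
  coef-*L≈single x y k a₀ others≈0 with below-or-offset a₀ (ord x) | below-or-offset k (ord x ℤ.+ ord y)
  ... | inj₁ a₀<ox         | _        = vanishing-single-term x y k a₀ others≈0 (inj₁ (coef-below-ord x a₀ a₀<ox))
  ... | inj₂ (j₀ , P.refl) | inj₁ k<o = vanishing-single-term x y k _ others≈0 (inj₂ (coef-below-ord y _ (k<a+o⇒k-a<o
    (ℤP.<-≤-trans k<o (ℤP.+-monoˡ-≤ (ord y) (ℤP.i≤i+j (ord x) (+ j₀)))))))
  ... | inj₂ (j₀ , P.refl) | inj₂ (M , P.refl) with j₀ ℕ.≤? M
  ...   | no j₀≰M  = vanishing-single-term x y ((ord x ℤ.+ ord y) ℤ.+ + M) (ord x ℤ.+ + j₀) others≈0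
    (inj₂ (coef-below-ord y _ (k<a+o⇒k-a<o
    (P.subst (((ord x ℤ.+ ord y) ℤ.+ + M) ℤ.<_) (swap (ord x) (ord y) (+ j₀))
      (ℤP.+-monoʳ-< (ord x ℤ.+ ord y) (ℤ.+<+ (ℕP.≰⇒> j₀≰M)))))))
    where
    swap : ∀ a b m → (a ℤ.+ b) ℤ.+ m ≡ (a ℤ.+ m) ℤ.+ b
    swap = solve-∀
  ...   | yes j₀≤M = trans (coef-*L-as-sum x y M) (sumF-single (suc M) j₀ (s≤s j₀≤M) (λ j _ j≢j₀ →
    x≈0⊎y≈0⇒x*y≈0 (others≈0 (ord x ℤ.+ + j) (λ e → j≢j₀ (ℤP.+-injective
      (P.trans (P.sym ([o+m]-o≡m (ord x) (+ j))) (P.trans (P.cong (ℤ._- ord x) e) ([o+m]-o≡m (ord x) (+ j₀)))))))))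

  coef-*L-shifted : ∀ A ζ {V e} → V ≡ ord A ℤ.+ + e → ValGe A V → ∀ m →
                    coef (A *L laurent (+ 1) ζ) ((V ℤ.+ + 1) ℤ.+ + m) ≈ sumF (λ j → coef A (V ℤ.+ + j) * ζ (m ∸ j)) (suc m)
  coef-*L-shifted A ζ {V} {e} V≡o+e A≥V m = begin
    coef (A *L z) ((V ℤ.+ + 1) ℤ.+ + m)                     ≡⟨ P.cong (coef (A *L z)) index ⟩
    coef (A *L z) ((ord A ℤ.+ + 1) ℤ.+ + (e ℕ.+ m))         ≡⟨ coef-ord+ (A *L z) (e ℕ.+ m) ⟩
    sumF (λ j → cf A j * ζ ((e ℕ.+ m) ∸ j)) (suc (e ℕ.+ m)) ≡⟨ P.cong (sumF _) (ℕP.+-suc e m) ⟨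
    sumF (λ j → cf A j * ζ ((e ℕ.+ m) ∸ j)) (e ℕ.+ suc m)   ≈⟨ sumF-++ _ e (suc m) ⟩
    sumF (λ j → cf A j * ζ ((e ℕ.+ m) ∸ j)) e
      + sumF (λ j → cf A (e ℕ.+ j) * ζ ((e ℕ.+ m) ∸ (e ℕ.+ j))) (suc m)
      ≈⟨ +-cong below-V (sumF-cong (suc m) (λ j _ →
           *-cong (cfA≈A_V+ j) (reflexive (P.cong ζ (ℕP.[m+n]∸[m+o]≡n∸o e m j))))) ⟩
    0# + sumF (λ j → coef A (V ℤ.+ + j) * ζ (m ∸ j)) (suc m) ≈⟨ +-identityˡ _ ⟩
    sumF (λ j → coef A (V ℤ.+ + j) * ζ (m ∸ j)) (suc m)      ∎
    where
    z = laurent (+ 1) ζ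
    index : (V ℤ.+ + 1) ℤ.+ + m ≡ (ord A ℤ.+ + 1) ℤ.+ + (e ℕ.+ m)
    index = P.trans (P.cong (λ i → (i ℤ.+ + 1) ℤ.+ + m) V≡o+e)
      (P.trans (regroup (ord A) (+ e) (+ m)) (P.cong (λ i → (ord A ℤ.+ + 1) ℤ.+ i) (P.sym (ℤP.pos-+ e m))))
      where
      regroup : ∀ o e m → ((o ℤ.+ e) ℤ.+ + 1) ℤ.+ m ≡ (o ℤ.+ + 1) ℤ.+ (e ℤ.+ m)
      regroup = solve-∀
    cfA≈A_V+ : ∀ j → cf A (e ℕ.+ j) ≈ coef A (V ℤ.+ + j)
    cfA≈A_V+ j = reflexive (P.trans (P.sym (coef-ord+ A (e ℕ.+ j)))
      (P.cong (coef A) (P.trans (P.cong (λ i → ord A ℤ.+ i) (ℤP.pos-+ e j))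
        (P.trans (P.sym (ℤP.+-assoc (ord A) (+ e) (+ j))) (P.cong (ℤ._+ + j) (P.sym V≡o+e))))))
    below-V : sumF (λ j → cf A j * ζ ((e ℕ.+ m) ∸ j)) e ≈ 0#
    below-V = sumF-zero e (λ j j<e → x≈0⊎y≈0⇒x*y≈0 (inj₁ (trans (reflexive (P.sym (coef-ord+ A j)))
      (A≥V _ (P.subst (ord A ℤ.+ + j ℤ.<_) (P.sym V≡o+e) (ℤP.+-monoʳ-< (ord A) (ℤ.+<+ j<e)))))))

  ValGe-*L : ∀ {x y u v} → ValGe x u → ValGe y v → ValGe (x *L y) (u ℤ.+ v)
  ValGe-*L {x} {y} {u} {v} x≥u y≥v k k<u+v = coef-*L≈0 x y k factor≈0
    where
    factor≈0 : ∀ a → coef x a ≈ 0# ⊎ coef y (k ℤ.- a) ≈ 0#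
    factor≈0 a with a ℤ.<? u
    ... | yes a<u = inj₁ (x≥u a a<u)
    ... | no  a≮u = inj₂ (y≥v _ (k<a+o⇒k-a<o (ℤP.<-≤-trans k<u+v (ℤP.+-monoˡ-≤ v (ℤP.≮⇒≥ a≮u)))))

  coef-*L-lead : ∀ {x y u v} → ValGe x u → ValGe y v → coef (x *L y) (u ℤ.+ v) ≈ coef x u * coef y v
  coef-*L-lead {x} {y} {u} {v} x≥u y≥v =
    trans (coef-*L≈single x y (u ℤ.+ v) u factor≈0) (*-congˡ (reflexive (P.cong (coef y) ([o+m]-o≡m u v))))
    where
    factor≈0 : ∀ a → a ≢ u → coef x a ≈ 0# ⊎ coef y ((u ℤ.+ v) ℤ.- a) ≈ 0#
    factor≈0 a a≢u with a ℤ.<? u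
    ... | yes a<u = inj₁ (x≥u a a<u)
    ... | no  a≮u =
      inj₂ (y≥v _ (k<a+o⇒k-a<o (ℤP.+-monoˡ-< v (ℤP.≤∧≢⇒< (ℤP.≮⇒≥ a≮u) (λ u≡a → a≢u (P.sym u≡a))))))

  private
    [1+n]*u≡u+n*u : ∀ u n → u ℤ.+ n ℤ.* u ≡ (+ 1 ℤ.+ n) ℤ.* u
    [1+n]*u≡u+n*u = solve-∀

  ValGe-^L : ∀ {x u} N → ValGe x u → ValGe (x ^L N) (+ N ℤ.* u)
  ValGe-^L {x} {u} zero    _   = P.subst (ValGe 1L) (P.sym (ℤP.*-zeroˡ u)) (ValGe-ord 1L)
  ValGe-^L {x} {u} (suc N) x≥u = P.subst (ValGe (x ^L suc N)) ([1+n]*u≡u+n*u u (+ N)) (ValGe-*L x≥u (ValGe-^L N x≥u))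

  coef-^L-lead : ∀ {x u} N → ValGe x u → coef (x ^L N) (+ N ℤ.* u) ≈ coef x u ^ N
  coef-^L-lead {x} {u} zero    _   = reflexive (P.cong (coef 1L) (ℤP.*-zeroˡ u))
  coef-^L-lead {x} {u} (suc N) x≥u = begin
    coef (x ^L suc N) (+ suc N ℤ.* u)        ≡⟨ P.cong (coef (x ^L suc N)) ([1+n]*u≡u+n*u u (+ N)) ⟨
    coef (x ^L suc N) (u ℤ.+ + N ℤ.* u)      ≈⟨ coef-*L-lead x≥u (ValGe-^L N x≥u) ⟩
    coef x u * coef (x ^L N) (+ N ℤ.* u)     ≈⟨ *-congˡ (coef-^L-lead N x≥u) ⟩
    coef x u * coef x u ^ N                  ∎

  ValGtFrac-*L : ∀ {x y u N D} → ValGe x u → ValGtFrac y N D → ValGtFrac (x *L y) (N ℤ.+ u ℤ.* + D) D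
  ValGtFrac-*L {x} {y} {u} {N} {D} x≥u y>N/D k kD≤N+uD = coef-*L≈0 x y k factor≈0
    where
    factor≈0 : ∀ a → coef x a ≈ 0# ⊎ coef y (k ℤ.- a) ≈ 0#
    factor≈0 a with a ℤ.<? u
    ... | yes a<u = inj₁ (x≥u a a<u)
    ... | no  a≮u = inj₂ (y>N/D (k ℤ.- a) (shifted-bound {k} {a} {u} {N} {D} kD≤N+uD (ℤP.≮⇒≥ a≮u)))

module LaurentFieldFacts {c ℓ} (R : CommutativeRing c ℓ) (field-R : Over.IsField R) where
  open CommutativeRing R
  open Over R
  open RingFacts R
  open FieldFacts R field-R
  open LaurentFacts R
  open import Relation.Binary.Reasoning.Setoid setoid

  HasVal-*L : ∀ {x y u v} → HasVal x u → HasVal y v → HasVal (x *L y) (u ℤ.+ v)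
  HasVal-*L (xᵤ≉0 , x≥u) (yᵥ≉0 , y≥v) =
    (λ lead≈0 → x≉0∧y≉0⇒x*y≉0 xᵤ≉0 yᵥ≉0 (trans (sym (coef-*L-lead x≥u y≥v)) lead≈0)) , ValGe-*L x≥u y≥v

  HasVal-^L : ∀ {x u} N → HasVal x u → HasVal (x ^L N) (+ N ℤ.* u)
  HasVal-^L N (xᵤ≉0 , x≥u) =
    (λ lead≈0 → x≉0⇒x^n≉0 xᵤ≉0 N (trans (sym (coef-^L-lead N x≥u)) lead≈0)) , ValGe-^L N x≥u

  ValGe-cancel-*L : ∀ {x y u v} → HasVal y v → ValGe (x *L y) (u ℤ.+ v) → ValGe x u
  ValGe-cancel-*L {x} {y} {u} {v} (yᵥ≉0 , y≥v) xy≥u+v k k<u with below-or-offset k (ord x)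
  ... | inj₁ k<o          = coef-below-ord x k k<o
  ... | inj₂ (m , P.refl) = below (suc m) _ (ℤP.+-monoʳ-< (ord x) (ℤ.+<+ (ℕP.n<1+n m))) k<u
    where
    below : ∀ d k → k ℤ.< ord x ℤ.+ + d → k ℤ.< u → coef x k ≈ 0#
    below zero    k k<o+0 _   = coef-below-ord x k (P.subst (k ℤ.<_) (ℤP.+-identityʳ (ord x)) k<o+0)
    below (suc d) k k<o+d+1 k<u with ℤP.<-cmp k (ord x ℤ.+ + d)
    ... | tri< k<o+d _ _ = below d k k<o+d k<u
    ... | tri> _ _ k>o+d =
      ⊥-elim (ℤP.<⇒≱ k<o+d+1 (P.subst (ℤ._≤ k) (suc[o+d]≡o+[1+d] (ord x) d) (ℤP.i<j⇒suc[i]≤j k>o+d)))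
    ... | tri≈ _ P.refl _ = y≉0∧x*y≈0⇒x≈0 yᵥ≉0 (begin
      coef x k * coef y v                 ≡⟨ P.cong (λ j → coef x k * coef y j) ([o+m]-o≡m k v) ⟨
      coef x k * coef y ((k ℤ.+ v) ℤ.- k) ≈⟨ coef-*L≈single x y (k ℤ.+ v) k others≈0 ⟨
      coef (x *L y) (k ℤ.+ v)             ≈⟨ xy≥u+v (k ℤ.+ v) (ℤP.+-monoˡ-< v k<u) ⟩
      0#                                  ∎)
      where
      others≈0 : ∀ a → a ≢ k → coef x a ≈ 0# ⊎ coef y ((k ℤ.+ v) ℤ.- a) ≈ 0#
      others≈0 a a≢k with ℤP.<-cmp a k
      ... | tri< a<k _ _ = inj₁ (below d a a<k (ℤP.<-trans a<k k<u))
      ... | tri≈ _ a≡k _ = ⊥-elim (a≢k a≡k)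
      ... | tri> _ _ a>k = inj₂ (y≥v _ (k<a+o⇒k-a<o (ℤP.+-monoˡ-< v a>k)))

  HasVal-quotient : ∀ {x y z v w} → (x *L y) ≈L z → HasVal y v → HasVal z w →
                    HasVal x (w ℤ.- v) × coef x (w ℤ.- v) * coef y v ≈ coef z w
  HasVal-quotient {x} {y} {z} {v} {w} xy≈z y-val (z-lead≉0 , z≥w) = (lead≉0 , x≥w-v) , lead
    where
    [w-v]+v≡w : (w ℤ.- v) ℤ.+ v ≡ w
    [w-v]+v≡w = P.sym (P.trans (k≡o+[k-o] w v) (ℤP.+-comm v (w ℤ.- v)))
    x≥w-v : ValGe x (w ℤ.- v)
    x≥w-v = ValGe-cancel-*L y-val (P.subst (ValGe (x *L y)) (P.sym [w-v]+v≡w) (ValGe-resp (≈L-sym xy≈z) z≥w))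
    lead : coef x (w ℤ.- v) * coef y v ≈ coef z w
    lead = begin
      coef x (w ℤ.- v) * coef y v          ≈⟨ coef-*L-lead x≥w-v (proj₂ y-val) ⟨
      coef (x *L y) ((w ℤ.- v) ℤ.+ v)      ≡⟨ P.cong (coef (x *L y)) [w-v]+v≡w ⟩
      coef (x *L y) w                      ≈⟨ xy≈z w ⟩
      coef z w                             ∎
    lead≉0 : ¬ (coef x (w ℤ.- v) ≈ 0#)
    lead≉0 lead≈0 = z-lead≉0 (trans (sym lead) (x≈0⊎y≈0⇒x*y≈0 (inj₁ lead≈0)))

  convolution-solvable : ∀ (α : ℕ → Carrier) → ¬ (α 0 ≈ 0#) → ∀ (ξ : ℕ → Carrier) →
                         ∃ λ ζ → ∀ m → sumF (λ j → α j * ζ (m ∸ j)) (suc m) ≈ ξ m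
  convolution-solvable α α₀≉0 ξ with proj₂ field-R (α 0) α₀≉0
  ... | α₀⁻¹ , α₀α₀⁻¹≈1 = ζ , solves
    where
    tail : (ℕ → Carrier) → ℕ → Carrier
    tail g m = sumF (λ j → α (suc j) * g (m ∸ suc j)) m
    next : (ℕ → Carrier) → ℕ → Carrier
    next g m = α₀⁻¹ * (ξ m - tail g m)
    -- iterating the triangular recursion k times gives the right values below index k
    approx : ℕ → ℕ → Carrier
    approx zero    = λ _ → 0#
    approx (suc k) = next (approx k)
    ζ : ℕ → Carrier
    ζ m = approx (suc m) m
    next-cong : ∀ {g g′} m → (∀ j → j ℕ.< m → g j ≈ g′ j) → next g m ≈ next g′ m
    next-cong m g≈g′ = *-congˡ (+-congˡ (-‿cong (sumF-cong m (λ j j<m →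
      *-congˡ (g≈g′ (m ∸ suc j) (ℕP.∸-monoʳ-< {m} {suc j} {0} ℕP.0<1+n j<m))))))
    approx-stable : ∀ k m → m ℕ.< k → approx (suc k) m ≈ approx k m
    approx-stable (suc k) m m<1+k = next-cong m (λ j j<m → approx-stable k j (ℕP.<-≤-trans j<m (ℕP.≤-pred m<1+k)))
    approx≈ζ : ∀ k m → m ℕ.< k → approx k m ≈ ζ m
    approx≈ζ (suc k) m m<1+k with m ℕ.≟ k
    ... | yes P.refl = refl
    ... | no  m≢k    = trans (approx-stable k m m<k) (approx≈ζ k m m<k)
      where
      m<k : m ℕ.< k
      m<k = ℕP.≤∧≢⇒< (ℕP.≤-pred m<1+k) m≢k
    solves : ∀ m → sumF (λ j → α j * ζ (m ∸ j)) (suc m) ≈ ξ m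
    solves m = begin
      sumF (λ j → α j * ζ (m ∸ j)) (suc m)        ≈⟨ sumF-head _ m ⟩
      α 0 * ζ m + tail ζ m                        ≈⟨ +-congʳ (*-congˡ (next-cong m (λ j j<m → approx≈ζ m j j<m))) ⟩
      α 0 * (α₀⁻¹ * (ξ m - tail ζ m)) + tail ζ m  ≈⟨ +-congʳ (*-assoc _ _ _) ⟨
      (α 0 * α₀⁻¹) * (ξ m - tail ζ m) + tail ζ m  ≈⟨ +-congʳ (trans (*-congʳ α₀α₀⁻¹≈1) (*-identityˡ _)) ⟩
      (ξ m - tail ζ m) + tail ζ m                 ≈⟨ [x-r]+r≈x (ξ m) (tail ζ m) ⟩
      ξ m                                         ∎

  InAP-of-ValGe : ∀ {A x V} → HasVal A V → ValGe x (V ℤ.+ + 1) → InAP A x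
  InAP-of-ValGe {A} {x} {V} (A_V≉0 , A≥V) x≥V+1 with below-or-offset V (ord A)
  ... | inj₁ V<o         = ⊥-elim (A_V≉0 (coef-below-ord A V V<o))
  ... | inj₂ (e , V≡o+e) with convolution-solvable (λ j → coef A (V ℤ.+ + j)) A₀≉0 (λ m → coef x ((V ℤ.+ + 1) ℤ.+ + m))
    where
    A₀≉0 : ¬ (coef A (V ℤ.+ + 0) ≈ 0#)
    A₀≉0 = P.subst (λ k → ¬ (coef A k ≈ 0#)) (P.sym (ℤP.+-identityʳ V)) A_V≉0
  ...   | ζ , αζ≈ξ = laurent (+ 1) ζ , ValGe-ord (laurent (+ 1) ζ) , x≈Az
    where
    x≈Az : x ≈L (A *L laurent (+ 1) ζ)
    x≈Az k with below-or-offset k (V ℤ.+ + 1)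
    ... | inj₁ k<V+1        = trans (x≥V+1 k k<V+1) (sym (ValGe-*L A≥V (ValGe-ord (laurent (+ 1) ζ)) k k<V+1))
    ... | inj₂ (m , P.refl) = sym (trans (coef-*L-shifted A ζ V≡o+e A≥V m) (αζ≈ξ m))

gap : (ℕ → ℤ) → ℕ → ℤ
gap w j = w (j ∸ 1) ℤ.- w j

-- the hypothesis on ε_i reads v_K(ε_i) > ε-numerator p n b w i / p^n
ε-numerator : ℕ → ℕ → ℕ → (ℕ → ℤ) → ℕ → ℤ
ε-numerator p n b w i =
  (ℤ.- (+ b)) ℤ.- (+ (p ℕ.^ n) ℤ.* ΣZ[ 1 , i ] (λ j → + (p ℕ.^ j) ℤ.* gap w j))
              ℤ.+ (+ (p ℕ.^ n) ℤ.* ΣZ[ suc i , n ] (λ j → (+ (p ℕ.^ n) ℤ.- + (p ℕ.^ j)) ℤ.* gap w j))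

module ΩValuations
  {c ℓ} (R : CommutativeRing c ℓ) (field-R : Over.IsField R)
  (p : ℕ) (prime-p : Prime p) (char-p : Over.HasChar R p)
  (n b : ℕ) (β : Over.Laurent R) (β-val : Over.HasVal R β (ℤ.- (+ b)))
  (Ω : ℕ → Over.Laurent R) (Ω₀≈1 : Over._≈L_ R (Ω 0) (Over.1L R))
  (w : ℕ → ℤ) (Ω-val : ∀ i → i ℕ.≤ n → Over.HasVal R (Ω i) (w i)) (w₀≡0 : w 0 ≡ + 0)
  (w-step : ∀ i → i ℕ.< n → w (suc i) ℤ.≤ w i)
  (residue-indep : Over.ResidueIndep R p n Ω β w)
  (Om : ℕ → ℕ → Over.Laurent R) (Om₀≈Ω : ∀ j → Over._≈L_ R (Om 0 j) (Ω j))
  (Om-rec : ∀ i j → suc i ℕ.≤ j → j ℕ.≤ n →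
            Over._≈L_ R (Over._*L_ R (Om (suc i) j) (Over.℘ R p (Om i (suc i)))) (Over.℘ R p (Om i j)))
  where
  open CommutativeRing R
  open Over R
  open RingFacts R
  open CharacteristicFacts R p prime-p char-p
  open FieldFacts R field-R
  open PrimeFieldFacts R field-R p prime-p char-p
  open LaurentFacts R
  open LaurentFieldFacts R field-R
  open import Relation.Binary.Reasoning.Setoid setoid

  w-antitone : ∀ i j → i ℕ.≤ j → j ℕ.≤ n → w j ℤ.≤ w i
  w-antitone i j i≤j j≤n with ℕP.m≤n⇒m<n∨m≡n i≤j
  ... | inj₂ P.refl = ℤP.≤-refl
  w-antitone i (suc j) i≤j j<n | inj₁ i<1+j =
    ℤP.≤-trans (w-step j j<n) (w-antitone i j (ℕP.≤-pred i<1+j) (ℕP.<⇒≤ j<n))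

  w-constant : ∀ s t → s ℕ.≤ t → t ℕ.≤ n → w t ≡ w s → ∀ k → s ℕ.≤ k → k ℕ.≤ t → w k ≡ w s
  w-constant s t s≤t t≤n wₜ≡wₛ k s≤k k≤t = ℤP.≤-antisym (w-antitone s k s≤k (ℕP.≤-trans k≤t t≤n))
    (P.subst (ℤ._≤ w k) wₜ≡wₛ (w-antitone k t k≤t t≤n))

  -- ν i j is the valuation of Ω_j^{(i)}.
  ν : ℕ → ℕ → ℤ
  ν i j = + (p ℕ.^ i) ℤ.* (w j ℤ.- w i)

  lead : ℕ → ℕ → Carrier
  lead i j = coef (Om i j) (ν i j)

  ν≤0 : ∀ i j → i ℕ.≤ j → j ℕ.≤ n → ν i j ℤ.≤ + 0
  ν≤0 i j i≤j j≤n = P.subst (ν i j ℤ.≤_) (ℤP.*-zeroʳ (+ (p ℕ.^ i)))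
    (ℤP.*-monoˡ-≤-nonNeg (+ (p ℕ.^ i)) (ℤP.i≤j⇒i-j≤0 (w-antitone i j i≤j j≤n)))

  ν≡0⇒w≡ : ∀ i j → ν i j ≡ + 0 → w j ≡ w i
  ν≡0⇒w≡ i j νᵢⱼ≡0 with ℤP.i*j≡0⇒i≡0∨j≡0 (+ (p ℕ.^ i)) νᵢⱼ≡0
  ... | inj₁ pⁱ≡0 = ⊥-elim (ℕP.<⇒≢ (p^e>0 i) (P.sym (ℤP.+-injective pⁱ≡0)))
  ... | inj₂ wⱼ-wᵢ≡0 = ℤP.i-j≡0⇒i≡j (w j) (w i) wⱼ-wᵢ≡0

  ν-resp-w : ∀ i j k → w k ≡ w j → ν i k ≡ ν i j
  ν-resp-w i j k wₖ≡wⱼ = P.cong (λ u → + (p ℕ.^ i) ℤ.* (u ℤ.- w i)) wₖ≡wⱼ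

  ν₀ : ∀ j → ν 0 j ≡ w j
  ν₀ j = P.trans (P.cong (λ u → + 1 ℤ.* (w j ℤ.- u)) w₀≡0) (1*[x-0]≡x (w j))
    where
    1*[x-0]≡x : ∀ x → + 1 ℤ.* (x ℤ.- + 0) ≡ x
    1*[x-0]≡x = solve-∀

  LeadIndep : ℕ → Set ℓ
  LeadIndep i = ∀ s t → i ℕ.≤ s → s ℕ.≤ t → t ℕ.≤ n → (∀ k → s ℕ.≤ k → k ℕ.≤ t → w k ≡ w s) →
                ∀ (a : ℕ → ℕ) → (∀ k → s ℕ.≤ k → k ℕ.≤ t → a k ℕ.< p) →
                ΣF[ s , t ] (λ k → natF (a k) * lead i k) ≈ 0# → ∀ k → s ℕ.≤ k → k ℕ.≤ t → a k ≡ 0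

  record Invariant (i : ℕ) : Set ℓ where
    field
      valuation   : ∀ j → i ℕ.≤ j → j ℕ.≤ n → HasVal (Om i j) (ν i j)
      lead-diag   : lead i i ≈ 1#
      independent : LeadIndep i

  lead₀≈ : ∀ k → lead 0 k ≈ coef (Ω k) (w k)
  lead₀≈ k = trans (reflexive (P.cong (coef (Om 0 k)) (ν₀ k))) (Om₀≈Ω k (w k))

  φⁿΩβ : ℕ → Laurent
  φⁿΩβ k = φ^ p n (Ω k) *L β

  φⁿΩβ-val : ∀ k → k ℕ.≤ n → HasVal (φⁿΩβ k) (+ (p ℕ.^ n) ℤ.* w k ℤ.+ ℤ.- (+ b))
  φⁿΩβ-val k k≤n = HasVal-*L (HasVal-^L (p ℕ.^ n) (Ω-val k k≤n)) β-val

  -- The leading term of Σ aₖ φⁿ(Ωₖ)β is the p^n-th power of Σ aₖ lead(Ωₖ), times lead(β).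
  combination-in-𝔓 : ∀ s t → s ℕ.≤ t → t ℕ.≤ n → (∀ k → s ℕ.≤ k → k ℕ.≤ t → w k ≡ w s) →
                      ∀ (a : ℕ → ℕ) → ΣF[ s , t ] (λ k → natF (a k) * coef (Ω k) (w k)) ≈ 0# →
                      InAP (φⁿΩβ s) (ΣL[ s , t ] (λ k → natF (a k) ·L φⁿΩβ k))
  combination-in-𝔓 s t s≤t t≤n w-const a relation =
    InAP-of-ValGe (φⁿΩβ-val s (ℕP.≤-trans s≤t t≤n)) (ValGe-suc X≥U X_U≈0)
    where
    q = p ℕ.^ n
    U = + q ℤ.* w s ℤ.+ ℤ.- (+ b)
    X = ΣL[ s , t ] (λ k → natF (a k) ·L φⁿΩβ k)
    in-block : ∀ k → s ℕ.≤ k → k ℕ.≤ t → HasVal (φⁿΩβ k) U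
    in-block k s≤k k≤t = P.subst (λ u → HasVal (φⁿΩβ k) (+ q ℤ.* u ℤ.+ ℤ.- (+ b))) (w-const k s≤k k≤t)
                                 (φⁿΩβ-val k (ℕP.≤-trans k≤t t≤n))
    lead-φⁿΩβ : ∀ k → s ℕ.≤ k → k ℕ.≤ t → coef (φⁿΩβ k) U ≈ coef (Ω k) (w k) ^ q * coef β (ℤ.- (+ b))
    lead-φⁿΩβ k s≤k k≤t = begin
      coef (φⁿΩβ k) U
        ≡⟨ P.cong (λ u → coef (φⁿΩβ k) (+ q ℤ.* u ℤ.+ ℤ.- (+ b))) (w-const k s≤k k≤t) ⟨
      coef (φⁿΩβ k) (+ q ℤ.* w k ℤ.+ ℤ.- (+ b))
        ≈⟨ coef-*L-lead (ValGe-^L q Ωₖ≥wₖ) (proj₂ β-val) ⟩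
      coef (Ω k ^L q) (+ q ℤ.* w k) * coef β (ℤ.- (+ b))
        ≈⟨ *-congʳ (coef-^L-lead q Ωₖ≥wₖ) ⟩
      coef (Ω k) (w k) ^ q * coef β (ℤ.- (+ b)) ∎
      where
      Ωₖ≥wₖ = proj₂ (Ω-val k (ℕP.≤-trans k≤t t≤n))
    X≥U : ValGe X U
    X≥U = ValGe-ΣL (λ k s≤k k≤t → ValGe-·L (proj₂ (in-block k s≤k k≤t)))
    X_U≈0 : coef X U ≈ 0#
    X_U≈0 = begin
      coef X U
        ≈⟨ coef-ΣL s t _ U ⟩
      ΣF[ s , t ] (λ k → coef (natF (a k) ·L φⁿΩβ k) U)
        ≈⟨ ΣF-cong s t (λ k s≤k k≤t → trans (coef-·L (natF (a k)) (φⁿΩβ k) U)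
             (trans (*-congˡ (lead-φⁿΩβ k s≤k k≤t)) (sym (*-assoc _ _ _)))) ⟩
      ΣF[ s , t ] (λ k → (natF (a k) * coef (Ω k) (w k) ^ q) * coef β (ℤ.- (+ b)))
        ≈⟨ ΣF-*ʳ (λ k → natF (a k) * coef (Ω k) (w k) ^ q) s t (coef β (ℤ.- (+ b))) ⟨
      ΣF[ s , t ] (λ k → natF (a k) * coef (Ω k) (w k) ^ q) * coef β (ℤ.- (+ b))
        ≈⟨ *-congʳ (frobenius^-ΣF n a (λ k → coef (Ω k) (w k)) s t) ⟨
      ΣF[ s , t ] (λ k → natF (a k) * coef (Ω k) (w k)) ^ q * coef β (ℤ.- (+ b))
        ≈⟨ *-congʳ (trans (^-congˡ q relation) (0^n≈0 q (p^e>0 n))) ⟩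
      0# * coef β (ℤ.- (+ b))
        ≈⟨ zeroˡ _ ⟩
      0# ∎

  independent₀ : LeadIndep 0
  independent₀ s t _ s≤t t≤n w-const a a<p relation k s≤k k≤t with ℕP.m≤n⇒m<n∨m≡n s≤t
  ... | inj₁ s<t    = residue-indep s t s<t t≤n w-const a a<p
                        (combination-in-𝔓 s t s≤t t≤n w-const a relation′) k s≤k k≤t
    where
    relation′ : ΣF[ s , t ] (λ k → natF (a k) * coef (Ω k) (w k)) ≈ 0#
    relation′ = trans (ΣF-cong {λ k → natF (a k) * coef (Ω k) (w k)} s t (λ k _ _ → *-congˡ (sym (lead₀≈ k))))
                      relation
  ... | inj₂ P.refl = P.subst (λ k → a k ≡ 0) (ℕP.≤-antisym s≤k k≤t)
    (natF≈0⇒≡0 (a s) (a<p s ℕP.≤-refl ℕP.≤-refl)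
      (y≉0∧x*y≈0⇒x≈0 (λ lead≈0 → proj₁ (Ω-val s t≤n) (trans (sym (lead₀≈ s)) lead≈0))
        (trans (sym (ΣF-singleton (λ k → natF (a k) * lead 0 k) s)) relation)))

  invariant₀ : Invariant 0
  invariant₀ = record
    { valuation   = λ j _ j≤n → P.subst (HasVal (Om 0 j)) (P.sym (ν₀ j)) (HasVal-resp (≈L-sym (Om₀≈Ω j)) (Ω-val j j≤n))
    ; lead-diag   = trans (reflexive (P.cong (coef (Om 0 0)) (P.trans (ν₀ 0) w₀≡0))) (trans (Om₀≈Ω 0 (+ 0)) (Ω₀≈1 (+ 0)))
    ; independent = independent₀
    }

  ν℘ : ℕ → ℕ → ℤ
  ν℘ i j = + p ℤ.* ν i j

  lead℘ : ℕ → ℕ → Carrier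
  lead℘ i j = coef (℘ p (Om i j)) (ν℘ i j)

  ν<0⊎ν≡0 : ∀ i j → i ℕ.≤ j → j ℕ.≤ n → ν i j ℤ.< + 0 ⊎ ν i j ≡ + 0
  ν<0⊎ν≡0 i j i≤j j≤n with ℤP.<-cmp (ν i j) (+ 0)
  ... | tri< ν<0 _ _ = inj₁ ν<0
  ... | tri≈ _ ν≡0 _ = inj₂ ν≡0
  ... | tri> _ _ ν>0 = ⊥-elim (ℤP.<⇒≱ ν>0 (ν≤0 i j i≤j j≤n))

  ν℘-shift : ∀ i j → ν℘ i j ℤ.- ν℘ i (suc i) ≡ ν (suc i) j
  ν℘-shift i j = P.trans (factor (+ p) (+ (p ℕ.^ i)) (w j) (w i) (w (suc i)))
                         (P.cong (λ q → q ℤ.* (w j ℤ.- w (suc i))) (P.sym (ℤP.pos-* p (p ℕ.^ i))))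
    where
    factor : ∀ a b x y z → a ℤ.* (b ℤ.* (x ℤ.- y)) ℤ.- a ℤ.* (b ℤ.* (z ℤ.- y)) ≡ (a ℤ.* b) ℤ.* (x ℤ.- z)
    factor = solve-∀

  module _ {i} (inv : Invariant i) where
    open Invariant inv

    ℘-ValGe : ∀ j → i ℕ.≤ j → j ℕ.≤ n → ValGe (℘ p (Om i j)) (ν℘ i j)
    ℘-ValGe j i≤j j≤n = ValGe-L- (ValGe-^L p Om≥ν) (ValGe-mono (n*v≤v p (ν i j) p>0 (ν≤0 i j i≤j j≤n)) Om≥ν)
      where Om≥ν = proj₂ (valuation j i≤j j≤n)

    lead℘-of-ν<0 : ∀ j → i ℕ.≤ j → j ℕ.≤ n → ν i j ℤ.< + 0 → lead℘ i j ≈ lead i j ^ p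
    lead℘-of-ν<0 j i≤j j≤n ν<0 = begin
      lead℘ i j                                                   ≈⟨ coef-L- _ _ (ν℘ i j) ⟩
      coef (Om i j ^L p) (ν℘ i j) - coef (Om i j) (ν℘ i j)        ≈⟨ +-cong (coef-^L-lead p Om≥ν)
                                                                     (-‿cong (Om≥ν _ (n*v<v p (ν i j) (prime>1 prime-p) ν<0))) ⟩
      lead i j ^ p - 0#                                           ≈⟨ trans (+-congˡ -0#≈0#) (+-identityʳ _) ⟩
      lead i j ^ p                                                ∎
      where Om≥ν = proj₂ (valuation j i≤j j≤n)

    lead℘-of-ν≡0 : ∀ j → i ℕ.≤ j → j ℕ.≤ n → ν i j ≡ + 0 → lead℘ i j ≈ lead i j ^ p - lead i j
    lead℘-of-ν≡0 j i≤j j≤n ν≡0 = trans (coef-L- _ _ (ν℘ i j))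
      (+-cong (coef-^L-lead p (proj₂ (valuation j i≤j j≤n)))
              (-‿cong (reflexive (P.cong (coef (Om i j)) pν≡ν))))
      where
      pν≡ν : ν℘ i j ≡ ν i j
      pν≡ν = P.trans (P.cong (+ p ℤ.*_) ν≡0) (P.trans (ℤP.*-zeroʳ (+ p)) (P.sym ν≡0))

    -- Since lead i i = 1, an 𝔽_p-relation with constant term adjoined at index i is again covered by
    -- the independence hypothesis.
    span-avoids-𝔽ₚ : ∀ s t → i ℕ.< s → s ℕ.≤ t → t ℕ.≤ n → w t ≡ w i →
                     ∀ (a : ℕ → ℕ) → (∀ k → s ℕ.≤ k → k ℕ.≤ t → a k ℕ.< p) →
                     ∀ a₀ → a₀ ℕ.< p → ΣF[ s , t ] (λ k → natF (a k) * lead i k) ≈ natF a₀ →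
                     ∀ k → s ℕ.≤ k → k ℕ.≤ t → a k ≡ 0
    span-avoids-𝔽ₚ s t i<s s≤t t≤n wₜ≡wᵢ a a<p a₀ a₀<p Σ≈a₀ k s≤k k≤t with 𝔽ₚ-negation a₀ a₀<p
    ... | a₀′ , a₀′<p , a₀′+a₀≈0 = P.trans (P.sym (adjoin-beyond i a₀′ a s k i<s s≤k))
      (independent i t ℕP.≤-refl i≤t t≤n (w-constant i t i≤t t≤n wₜ≡wᵢ) (adjoin i a₀′ a s)
        (λ k _ k≤t → adjoin-< i a₀′ a s t p>0 a₀′<p a<p k k≤t) relation k (ℕP.≤-trans (ℕP.<⇒≤ i<s) s≤k) k≤t)
      where
      i≤t : i ℕ.≤ t
      i≤t = ℕP.≤-trans (ℕP.<⇒≤ i<s) s≤t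
      relation : ΣF[ i , t ] (λ k → natF (adjoin i a₀′ a s k) * lead i k) ≈ 0#
      relation = begin
        ΣF[ i , t ] (λ k → natF (adjoin i a₀′ a s k) * lead i k)      ≈⟨ ΣF-adjoin (lead i) i a₀′ a s t i<s s≤t ⟩
        natF a₀′ * lead i i + ΣF[ s , t ] (λ k → natF (a k) * lead i k)
          ≈⟨ +-cong (trans (*-congˡ lead-diag) (*-identityʳ _)) Σ≈a₀ ⟩
        natF a₀′ + natF a₀                                             ≈⟨ a₀′+a₀≈0 ⟩
        0#                                                            ∎

    lead∉𝔽ₚ : ∀ j → i ℕ.< j → j ℕ.≤ n → w j ≡ w i → ¬ (∃ λ a₀ → a₀ ℕ.< p × lead i j ≈ natF a₀)
    lead∉𝔽ₚ j i<j j≤n wⱼ≡wᵢ (a₀ , a₀<p , lead≈a₀) with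
      span-avoids-𝔽ₚ j j i<j ℕP.≤-refl j≤n wⱼ≡wᵢ (λ _ → 1) (λ _ _ _ → prime>1 prime-p) a₀ a₀<p
        (trans (ΣF-singleton (λ k → natF 1 * lead i k) j) (trans (*-congʳ natF-1) (trans (*-identityˡ _) lead≈a₀)))
        j ℕP.≤-refl ℕP.≤-refl
    ... | ()

    lead℘≉0 : ∀ j → i ℕ.< j → j ℕ.≤ n → ¬ (lead℘ i j ≈ 0#)
    lead℘≉0 j i<j j≤n lead℘≈0 with ν<0⊎ν≡0 i j (ℕP.<⇒≤ i<j) j≤n
    ... | inj₁ ν<0 = x≉0⇒x^n≉0 (proj₁ (valuation j (ℕP.<⇒≤ i<j) j≤n)) p
                       (trans (sym (lead℘-of-ν<0 j (ℕP.<⇒≤ i<j) j≤n ν<0)) lead℘≈0)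
    ... | inj₂ ν≡0 = fixed-by-frobenius⇒∈𝔽ₚ (lead i j)
                       (x∙y⁻¹≈ε⇒x≈y _ _ (trans (sym (lead℘-of-ν≡0 j (ℕP.<⇒≤ i<j) j≤n ν≡0)) lead℘≈0))
                       (lead∉𝔽ₚ j i<j j≤n (ν≡0⇒w≡ i j ν≡0))

    ℘-HasVal : ∀ j → i ℕ.< j → j ℕ.≤ n → HasVal (℘ p (Om i j)) (ν℘ i j)
    ℘-HasVal j i<j j≤n = lead℘≉0 j i<j j≤n , ℘-ValGe j (ℕP.<⇒≤ i<j) j≤n

    module _ {s t} (i<s : i ℕ.< s) (s≤t : s ℕ.≤ t) (t≤n : t ℕ.≤ n)
             (w-const : ∀ k → s ℕ.≤ k → k ℕ.≤ t → w k ≡ w s) (a : ℕ → ℕ) where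
      private
        lead℘≈ : ∀ {f : ℕ → Carrier} → (∀ k → i ℕ.≤ k → k ℕ.≤ n → ν i k ≡ ν i s → lead℘ i k ≈ f k) →
                 ΣF[ s , t ] (λ k → natF (a k) * lead℘ i k) ≈ ΣF[ s , t ] (λ k → natF (a k) * f k)
        lead℘≈ lead℘≈f = ΣF-cong {λ k → natF (a k) * lead℘ i k} s t (λ k s≤k k≤t →
          *-congˡ (lead℘≈f k (ℕP.<⇒≤ (ℕP.<-≤-trans i<s s≤k)) (ℕP.≤-trans k≤t t≤n)
                              (ν-resp-w i s k (w-const k s≤k k≤t))))

      ΣF-lead℘-of-ν<0 : ν i s ℤ.< + 0 →
                        ΣF[ s , t ] (λ k → natF (a k) * lead℘ i k) ≈ ΣF[ s , t ] (λ k → natF (a k) * lead i k) ^ p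
      ΣF-lead℘-of-ν<0 ν<0 = trans
        (lead℘≈ (λ k i≤k k≤n νₖ≡νₛ → lead℘-of-ν<0 k i≤k k≤n (P.subst (ℤ._< + 0) (P.sym νₖ≡νₛ) ν<0)))
                                  (sym (frobenius-ΣF a (lead i) s t))

      ΣF-lead℘-of-ν≡0 : ν i s ≡ + 0 →
                        ΣF[ s , t ] (λ k → natF (a k) * lead℘ i k) ≈
                        ΣF[ s , t ] (λ k → natF (a k) * lead i k) ^ p - ΣF[ s , t ] (λ k → natF (a k) * lead i k)
      ΣF-lead℘-of-ν≡0 ν≡0 = begin
        ΣF[ s , t ] (λ k → natF (a k) * lead℘ i k)
          ≈⟨ lead℘≈ (λ k i≤k k≤n νₖ≡νₛ → lead℘-of-ν≡0 k i≤k k≤n (P.trans νₖ≡νₛ ν≡0)) ⟩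
        ΣF[ s , t ] (λ k → natF (a k) * (lead i k ^ p - lead i k))
          ≈⟨ ΣF-cong {λ k → natF (a k) * (lead i k ^ p - lead i k)} s t
               (λ k _ _ → x[y-z]≈xy-xz (natF (a k)) (lead i k ^ p) (lead i k)) ⟩
        ΣF[ s , t ] (λ k → natF (a k) * lead i k ^ p - natF (a k) * lead i k)
          ≈⟨ ΣF-- (λ k → natF (a k) * lead i k ^ p) (λ k → natF (a k) * lead i k) s t ⟩
        ΣF[ s , t ] (λ k → natF (a k) * lead i k ^ p) - Y
          ≈⟨ +-congʳ (frobenius-ΣF a (lead i) s t) ⟨
        Y ^ p - Y ∎
        where
        Y = ΣF[ s , t ] (λ k → natF (a k) * lead i k)

    independence-step : ∀ D → ¬ (D ≈ 0#) → (∀ k → i ℕ.< k → k ℕ.≤ n → lead (suc i) k * D ≈ lead℘ i k) →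
                        LeadIndep (suc i)
    independence-step D D≉0 lead-rel s t i<s s≤t t≤n w-const a a<p relation k s≤k k≤t =
      decidable-stable (a k ℕ.≟ 0) aₖ≡0
      where
      Y = ΣF[ s , t ] (λ k → natF (a k) * lead i k)
      relation℘ : ΣF[ s , t ] (λ k → natF (a k) * lead℘ i k) ≈ 0#
      relation℘ = begin
        ΣF[ s , t ] (λ k → natF (a k) * lead℘ i k)
          ≈⟨ ΣF-cong {λ k → natF (a k) * lead℘ i k} s t
               (λ k s≤k k≤t → *-congˡ (sym (lead-rel k (ℕP.<-≤-trans i<s s≤k) (ℕP.≤-trans k≤t t≤n)))) ⟩
        ΣF[ s , t ] (λ k → natF (a k) * (lead (suc i) k * D))
          ≈⟨ ΣF-cong {λ k → (natF (a k) * lead (suc i) k) * D} s t (λ k _ _ → *-assoc (natF (a k)) (lead (suc i) k) D) ⟨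
        ΣF[ s , t ] (λ k → (natF (a k) * lead (suc i) k) * D)
          ≈⟨ ΣF-*ʳ (λ k → natF (a k) * lead (suc i) k) s t D ⟨
        ΣF[ s , t ] (λ k → natF (a k) * lead (suc i) k) * D
          ≈⟨ trans (*-congʳ relation) (zeroˡ D) ⟩
        0# ∎
      aₖ≡0 : ¬ ¬ (a k ≡ 0)
      aₖ≡0 aₖ≢0 with ν<0⊎ν≡0 i s (ℕP.<⇒≤ i<s) (ℕP.≤-trans s≤t t≤n)
      ... | inj₁ ν<0 = x≉0⇒x^n≉0 Y≉0 p (trans (sym (ΣF-lead℘-of-ν<0 i<s s≤t t≤n w-const a ν<0)) relation℘)
        where
        Y≉0 : ¬ (Y ≈ 0#)
        Y≉0 Y≈0 = aₖ≢0 (independent s t (ℕP.<⇒≤ i<s) s≤t t≤n w-const a a<p Y≈0 k s≤k k≤t)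
      ... | inj₂ ν≡0 = fixed-by-frobenius⇒∈𝔽ₚ Y
        (x∙y⁻¹≈ε⇒x≈y _ _ (trans (sym (ΣF-lead℘-of-ν≡0 i<s s≤t t≤n w-const a ν≡0)) relation℘))
        (λ { (a₀ , a₀<p , Y≈a₀) →
               aₖ≢0 (span-avoids-𝔽ₚ s t i<s s≤t t≤n wₜ≡wᵢ a a<p a₀ a₀<p Y≈a₀ k s≤k k≤t) })
        where
        wₜ≡wᵢ : w t ≡ w i
        wₜ≡wᵢ = P.trans (w-const t s≤t ℕP.≤-refl) (ν≡0⇒w≡ i s ν≡0)

  invariant-step : ∀ i → Invariant i → suc i ℕ.≤ n → Invariant (suc i)
  invariant-step i inv i<n = record
    { valuation   = λ j i<j j≤n → proj₁ (quotient j i<j j≤n)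
    ; lead-diag   = *-cancelʳ-≉0 D≉0 (trans (proj₂ (quotient (suc i) ℕP.≤-refl i<n)) (sym (*-identityˡ D)))
    ; independent = independence-step inv D D≉0 (λ k i<k k≤n → proj₂ (quotient k i<k k≤n))
    }
    where
    D = lead℘ i (suc i)
    D≉0 = lead℘≉0 inv (suc i) ℕP.≤-refl i<n
    quotient : ∀ j → suc i ℕ.≤ j → j ℕ.≤ n → HasVal (Om (suc i) j) (ν (suc i) j) × lead (suc i) j * D ≈ lead℘ i j
    quotient j i<j j≤n with HasVal-quotient (Om-rec i j i<j j≤n) (℘-HasVal inv (suc i) ℕP.≤-refl i<n) (℘-HasVal inv j i<j j≤n)
    ... | val , lead-eq = P.subst (HasVal (Om (suc i) j)) (ν℘-shift i j) val ,
                          trans (*-congʳ (reflexive (P.cong (coef (Om (suc i) j)) (P.sym (ν℘-shift i j))))) lead-eq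

  invariant : ∀ i → i ℕ.≤ n → Invariant i
  invariant zero    _     = invariant₀
  invariant (suc i) 1+i≤n = invariant-step i (invariant i (ℕP.<⇒≤ 1+i≤n)) 1+i≤n

  Om-ValGe : ∀ i j → i ℕ.≤ j → j ℕ.≤ n → ValGe (Om i j) (ν i j)
  Om-ValGe i j i≤j j≤n = proj₂ (Invariant.valuation (invariant i (ℕP.≤-trans i≤j j≤n)) j i≤j j≤n)

module ErrorBounds
  {c ℓ} (R : CommutativeRing c ℓ) (p : ℕ) (p>0 : 0 ℕ.< p) (n b : ℕ) (b>0 : 0 ℕ.< b)
  (w : ℕ → ℤ) (w-step : ∀ i → i ℕ.< n → w (suc i) ℤ.≤ w i)
  (ε : ℕ → Over.Laurent R)
  (ε-bound : ∀ i → 1 ℕ.≤ i → i ℕ.≤ n → Over.ValGtFrac R (ε i) (ε-numerator p n b w i) (p ℕ.^ n))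
  (Om : ℕ → ℕ → Over.Laurent R)
  (Om-ValGe : ∀ i j → i ℕ.≤ j → j ℕ.≤ n → Over.ValGe R (Om i j) (+ (p ℕ.^ i) ℤ.* (w j ℤ.- w i)))
  where
  open CommutativeRing R
  open Over R
  open LaurentFacts R

  P : ℕ → ℤ
  P k = + (p ℕ.^ k)

  N : ℕ → ℤ
  N = ε-numerator p n b w

  N-step : ∀ j → j ℕ.< n → N (suc j) ≡ N j ℤ.+ (P n ℤ.* P n) ℤ.* (w (suc j) ℤ.- w j)
  N-step j j<n = P.trans (regroup (+ b) (P n) (ΣZ[ 1 , j ] f) (P (suc j)) (w j) (w (suc j)) (ΣZ[ suc (suc j) , n ] g))
    (P.cong (λ T → (ℤ.- (+ b) ℤ.- P n ℤ.* ΣZ[ 1 , j ] f ℤ.+ P n ℤ.* T) ℤ.+ (P n ℤ.* P n) ℤ.* (w (suc j) ℤ.- w j))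
            (P.sym ΣZ[j+1,n]≡))
    where
    f g : ℕ → ℤ
    f l = P l ℤ.* gap w l
    g l = (P n ℤ.- P l) ℤ.* gap w l
    ΣZ[j+1,n]≡ : ΣZ[ suc j , n ] g ≡ g (suc j) ℤ.+ ΣZ[ suc (suc j) , n ] g
    ΣZ[j+1,n]≡ = P.trans (P.cong (sumFromZ g (suc j)) (ℕP.+-∸-assoc 1 j<n)) (sumFromZ-head (suc j) (n ∸ suc j))
      where
      sumFromZ-head : ∀ a l → sumFromZ g a (suc l) ≡ g a ℤ.+ sumFromZ g (suc a) l
      sumFromZ-head a zero    = P.trans (ℤP.+-identityˡ _)
                                  (P.trans (P.cong g (ℕP.+-identityʳ a)) (P.sym (ℤP.+-identityʳ (g a))))
      sumFromZ-head a (suc l) = P.trans (P.cong₂ ℤ._+_ (sumFromZ-head a l) (P.cong g (ℕP.+-suc a l)))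
                                        (ℤP.+-assoc (g a) _ _)
    regroup : ∀ b pn s psj wj wsj t →
              (ℤ.- b) ℤ.- (pn ℤ.* (s ℤ.+ psj ℤ.* (wj ℤ.- wsj))) ℤ.+ (pn ℤ.* t) ≡
              ((ℤ.- b) ℤ.- (pn ℤ.* s) ℤ.+ (pn ℤ.* ((pn ℤ.- psj) ℤ.* (wj ℤ.- wsj) ℤ.+ t)))
                ℤ.+ (pn ℤ.* pn) ℤ.* (wsj ℤ.- wj)
    regroup = solve-∀

  N-telescope : ∀ i j → i ℕ.≤ j → j ℕ.≤ n → N j ≡ N i ℤ.+ (P n ℤ.* P n) ℤ.* (w j ℤ.- w i)
  N-telescope i j i≤j j≤n with ℕP.m≤n⇒m<n∨m≡n i≤j
  ... | inj₂ P.refl = x≡x+c[a-a] (N i) (P n ℤ.* P n) (w i)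
    where
    x≡x+c[a-a] : ∀ x c a → x ≡ x ℤ.+ c ℤ.* (a ℤ.- a)
    x≡x+c[a-a] = solve-∀
  N-telescope i (suc j) i≤j j<n | inj₁ i<1+j = P.trans (N-step j j<n)
    (P.trans (P.cong (λ t → t ℤ.+ (P n ℤ.* P n) ℤ.* (w (suc j) ℤ.- w j))
                     (N-telescope i j (ℕP.≤-pred i<1+j) (ℕP.<⇒≤ j<n)))
             (telescope (N i) (P n ℤ.* P n) (w i) (w j) (w (suc j))))
    where
    telescope : ∀ x c a b d → (x ℤ.+ c ℤ.* (b ℤ.- a)) ℤ.+ c ℤ.* (d ℤ.- b) ≡ x ℤ.+ c ℤ.* (d ℤ.- a)
    telescope = solve-∀

  E-bound : ∀ i j → i ℕ.< j → j ℕ.≤ n → ValGtFrac (E p n Om ε j i) (N j) (p ℕ.^ n)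
  E-bound zero    j 0<j j≤n = ε-bound j 0<j j≤n
  E-bound (suc i) j i<j j≤n = ValGtFrac-L- (E-bound i j (ℕP.<-trans (ℕP.n<1+n i) i<j) j≤n)
    (ValGtFrac-mono (ℤP.≤-reflexive Nⱼ≡)
      (ValGtFrac-*L (ValGe-^L (p ℕ.^ (n ∸ suc i)) (Om-ValGe (suc i) j (ℕP.<⇒≤ i<j) j≤n))
                    (E-bound i (suc i) ℕP.≤-refl 1+i≤n)))
    where
    1+i≤n : suc i ℕ.≤ n
    1+i≤n = ℕP.<⇒≤ (ℕP.<-≤-trans i<j j≤n)
    ν = + (p ℕ.^ suc i) ℤ.* (w j ℤ.- w (suc i))
    pⁿ⁻ⁱpⁱ≡pⁿ : + (p ℕ.^ (n ∸ suc i)) ℤ.* P (suc i) ≡ P n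
    pⁿ⁻ⁱpⁱ≡pⁿ = P.trans (P.sym (ℤP.pos-* (p ℕ.^ (n ∸ suc i)) (p ℕ.^ suc i)))
      (P.cong +_ (P.trans (P.sym (ℕP.^-distribˡ-+-* p (n ∸ suc i) (suc i))) (P.cong (p ℕ.^_) (ℕP.m∸n+n≡m 1+i≤n))))
    Nⱼ≡ : N j ≡ N (suc i) ℤ.+ (+ (p ℕ.^ (n ∸ suc i)) ℤ.* ν) ℤ.* P n
    Nⱼ≡ = P.trans (N-telescope (suc i) j (ℕP.<⇒≤ i<j) j≤n) (P.cong (λ t → N (suc i) ℤ.+ t) (P.trans
      (P.cong (λ t → (t ℤ.* P n) ℤ.* (w j ℤ.- w (suc i))) (P.sym pⁿ⁻ⁱpⁱ≡pⁿ))
      (reassoc (+ (p ℕ.^ (n ∸ suc i))) (P (suc i)) (P n) (w j ℤ.- w (suc i)))))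
      where
      reassoc : ∀ a b c d → ((a ℤ.* b) ℤ.* c) ℤ.* d ≡ (a ℤ.* (b ℤ.* d)) ℤ.* c
      reassoc = solve-∀

  b₍_₎ : ℕ → ℤ
  b₍ i ₎ = + b ℤ.+ (P n ℤ.* ΣZ[ 1 , i ] (λ j → P j ℤ.* gap w j))

  gap≥0 : ∀ j → 1 ℕ.≤ j → j ℕ.≤ n → + 0 ℤ.≤ gap w j
  gap≥0 (suc j) _ j<n = ℤP.i≤j⇒0≤j-i (w-step j j<n)

  P≥0 : ∀ k → + 0 ℤ.≤ P k
  P≥0 k = ℤ.+≤+ z≤n

  ΣZ-gaps≥0 : ∀ (c : ℕ → ℤ) s t → t ℕ.≤ n → (∀ j → j ℕ.≤ n → + 0 ℤ.≤ c j) →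
              + 0 ℤ.≤ ΣZ[ suc s , t ] (λ j → c j ℤ.* gap w j)
  ΣZ-gaps≥0 c s t t≤n c≥0 = ΣZ-nonneg _ (suc s) t (λ j 1+s≤j j≤t →
    *-nonneg (c≥0 j (ℕP.≤-trans j≤t t≤n)) (gap≥0 j (ℕP.≤-trans (s≤s z≤n) 1+s≤j) (ℕP.≤-trans j≤t t≤n)))

  -b₍i₎<0 : ∀ i → i ℕ.≤ n → ℤ.- b₍ i ₎ ℤ.< + 0
  -b₍i₎<0 i i≤n = ℤP.neg-mono-< (ℤP.<-≤-trans (ℤ.+<+ b>0)
    (x≤x+y (*-nonneg (P≥0 n) (ΣZ-gaps≥0 P 0 i i≤n (λ j _ → P≥0 j)))))

  -b₍i₎≤N : ∀ i → i ℕ.≤ n → ℤ.- b₍ i ₎ ℤ.≤ N i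
  -b₍i₎≤N i i≤n = P.subst (ℤ.- b₍ i ₎ ℤ.≤_) (P.sym (regroup (+ b) (P n) (ΣZ[ 1 , i ] f) (ΣZ[ suc i , n ] g)))
    (x≤x+y (*-nonneg (P≥0 n) (ΣZ-gaps≥0 (λ j → P n ℤ.- P j) i n ℕP.≤-refl
      (λ j j≤n → ℤP.i≤j⇒0≤j-i (ℤ.+≤+ (ℕP.^-monoʳ-≤ p ⦃ ℕ.>-nonZero p>0 ⦄ j≤n))))))
    where
    f g : ℕ → ℤ
    f j = P j ℤ.* gap w j
    g j = (P n ℤ.- P j) ℤ.* gap w j
    regroup : ∀ b pn s₁ s₂ →
              (ℤ.- b) ℤ.- (pn ℤ.* s₁) ℤ.+ (pn ℤ.* s₂) ≡ ℤ.- (b ℤ.+ pn ℤ.* s₁) ℤ.+ pn ℤ.* s₂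
    regroup = solve-∀

  E-bound-diag : ∀ i → 1 ℕ.≤ i → i ℕ.≤ n → ValGtFrac (E p n Om ε i (i ∸ 1)) (ℤ.- b₍ i ₎) (p ℕ.^ i)
  E-bound-diag (suc i) _ i<n = ValGtFrac-weaken (-b₍i₎<0 (suc i) i<n)
    (ℕP.^-monoʳ-≤ p ⦃ ℕ.>-nonZero p>0 ⦄ i<n) (-b₍i₎≤N (suc i) i<n) (E-bound i (suc i) ℕP.≤-refl i<n)

lemma4p3 :
  ∀ {c ℓ : Level} (R : CommutativeRing c ℓ) → let open Over R in
  (p : ℕ) → Prime p → AdmissibleField p →
  (n b : ℕ) → 0 ℕ.< b → Coprime b p →
  (β : Laurent) → HasVal β (ℤ.- (+ b)) →
  (Ω : ℕ → Laurent) → Ω 0 ≈L 1L → LinIndepFp p n Ω →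
  (w : ℕ → ℤ) → (∀ i → i ℕ.≤ n → HasVal (Ω i) (w i)) → w 0 ≡ + 0 →
  (∀ i → i ℕ.< n → w (suc i) ℤ.≤ w i) →
  ResidueIndep p n Ω β w →
  (ε : ℕ → Laurent) → ε 0 ≈L 0L →
  (let m : ℕ → ℤ
       m j = w (j ∸ 1) ℤ.- w j
       P : ℕ → ℤ
       P k = + (p ℕ.^ k)
   in
   ∀ i → 1 ℕ.≤ i → i ℕ.≤ n →
     ValGtFrac (ε i)
       ((ℤ.- (+ b))
         ℤ.- (P n ℤ.* ΣZ[ 1 , i ] (λ j → P j ℤ.* m j))
         ℤ.+ (P n ℤ.* ΣZ[ suc i , n ] (λ j → (P n ℤ.- P j) ℤ.* m j)))
       (p ℕ.^ n)) →
  (Om : ℕ → ℕ → Laurent) →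
  (∀ j → Om 0 j ≈L Ω j) →
  (∀ i j → suc i ℕ.≤ j → j ℕ.≤ n →
     (Om (suc i) j *L ℘ p (Om i (suc i))) ≈L ℘ p (Om i j)) →
  let m : ℕ → ℤ
      m j = w (j ∸ 1) ℤ.- w j
      P : ℕ → ℤ
      P k = + (p ℕ.^ k)
      b₍_₎ : ℕ → ℤ
      b₍ i ₎ = + b ℤ.+ (P n ℤ.* ΣZ[ 1 , i ] (λ j → P j ℤ.* m j))
  in
  ∀ i → 1 ℕ.≤ i → i ℕ.≤ n →
    ValGtFrac (E p n Om ε i (i ∸ 1)) (ℤ.- b₍ i ₎) (p ℕ.^ i)
lemma4p3 R p prime-p (field-R , char-p , _) n b b>0 _ β β-val Ω Ω₀≈1 _ w Ω-val w₀≡0 w-step residue-indep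
         ε _ ε-bound Om Om₀≈Ω Om-rec =
  ErrorBounds.E-bound-diag R p (prime>0 prime-p) n b b>0 w w-step ε ε-bound Om
    (ΩValuations.Om-ValGe R field-R p prime-p char-p n b β β-val Ω Ω₀≈1 w Ω-val w₀≡0 w-step residue-indep
                          Om Om₀≈Ω Om-rec)
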